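{- Let $2\le k\le n-2$ and $2\le m\le k$. Let $1\le i_1<j_1<i_2<j_2<\cdots<i_m<j_m\le n$, put $I=\{i_1,\ldots,i_m\}$, $J=\{j_1,\ldots,j_m\}$, and let $L\subseteq[n]\setminus(I\cup J)$ with $|L|=k-m$. Consider the $m$-dimensional cube $$\mathcal C^{(L)}_{I,J}=\{x\in\Delta_{k,n}: x_{i_a}+x_{j_a}=1\ (a=1,\ldots,m),\ x_\ell=1\ (\ell\in L)\},$$ whose vertices are the points $e_{M\cup L}$ with $M\subseteq I\cup J$ containing exactly one element of each pair $\{i_a,j_a\}$; a long diagonal is a pair of antipodal vertices $(e_{M\cup L},e_{\bar M\cup L})$ where $\bar M=(I\cup J)\setminus M$. Then for any two long diagonals $(e_{M_1\cup L},e_{M_2\cup L})$ and $(e_{M_1'\cup L},e_{M_2'\cup L})$, $$v_{M_1\cup L}+v_{M_2\cup L}=v_{M_1'\cup L}+v_{M_2'\cup L}\quad\text{and}\quad \gamma_{M_1\cup L}+\gamma_{M_2\cup L}=\gamma_{M_1'\cup L}+\gamma_{M_2'\cup L}.$$ Moreover, there is a unique pair of antipodal vertices of $\mathcal C^{(L)}_{I,J}$ forming a noncrossing pair, namely $(e_{M_1''\cup L},e_{M_2''\cup L})$ with $M_1''=\{i_1,j_2,i_3,j_4,\ldots\}$ (taking $i_a$ for $a$ odd and $j_a$ for $a$ even, $a=1,\ldots,m$) and $M_2''=\{j_1,i_2,j_3,i_4,\ldots\}=(I\cup J)\setminus M_1''$.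
   Context: $[n]=\{1,\ldots,n\}$, $e_1,\ldots,e_n$ the standard basis of $\mathbb R^n$, $e_S=\sum_{s\in S}e_s$, and $\Delta_{k,n}=\{x\in[0,1]^n:\sum_j x_j=k\}$ is the hypersimplex. Let $e_{i,j}$, $(i,j)\in[1,k-1]\times[1,n-k]$, be the standard basis of $\mathbb R^{(k-1)\times(n-k)}$ with coordinate functions $\alpha_{i,j}$; for integers $a,b$ put $\alpha_{i,[a,b]}=\sum_{t=a}^b\alpha_{i,t}$ (zero if $a>b$). Define $f_{i,j}=e_{i,j}-e_{i,j+1}$ for $1\le j\le n-k-1$ and $f_{i,n-k}=e_{i,n-k}-e_{i,1}$, and $f_{i,[a,b]}=\sum_{t=a}^bf_{i,t}$ (zero if $a>b$). For $S=\{s_1<\cdots<s_k\}\subseteq[n]$ define the linear function $\gamma_S(\alpha)=\sum_{i=1}^{k-1}\alpha_{i,[s_i-(i-1),\,s_{i+1}-i-1]}$ and the vector $v_S=\sum_{\ell=1}^{k-1}f_{\ell,[s_\ell-(\ell-1),\,s_{\ell+1}-\ell-1]}$. Two $r$-element subsets $A,B\subseteq[n]$ are weakly separated if there are no four elements $a,b,c,d$, appearing in this cyclic order in $(1,2,\ldots,n)$, with $a,c\in A\setminus B$ and $b,d\in B\setminus A$. Two $k$-subsets $A=\{a_1<\cdots<a_k\}$, $B=\{b_1<\cdots<b_k\}$ are noncrossing if for every $1\le p<q\le k$, either $\{a_p,\ldots,a_q\}$ and $\{b_p,\ldots,b_q\}$ are weakly separated, or $\{a_{p+1},\ldots,a_{q-1}\}\neq\{b_{p+1},\ldots,b_{q-1}\}$.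 -}

module Defs where

open import Data.Bool using (Bool; true; false; not; _∧_; if_then_else_)
open import Data.Nat using (ℕ; zero; suc; _∸_; _<_; _≡ᵇ_; _<ᵇ_)
import Data.Nat as ℕ
open import Data.Integer using (ℤ; +_; _+_; _-_)
open import Data.Fin using (Fin; toℕ)
open import Data.Fin.Subset using (Subset; inside; outside; ⁅_⁆; ⋃; _∪_; _─_)
open import Data.List using (List; []; _∷_; map; foldr; upTo; allFin; take; drop)
open import Data.List.Membership.Propositional using (_∈_; _∉_)
open import Data.Vec using (Vec; []; _∷_)
open import Data.Product using (_×_; ∃-syntax)
open import Data.Sum using (_⊎_)
open import Relation.Nullary using (¬_)
open import Data.Nat.Properties using ()

-- Generic helpers (all indices below are 1-based natural numbers)

elemsFrom : ∀ {n} → ℕ → Subset n → List ℕ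
elemsFrom o []              = []
elemsFrom o (true  ∷ S)     = suc o ∷ elemsFrom (suc o) S
elemsFrom o (false ∷ S)     = elemsFrom (suc o) S

elems : ∀ {n} → Subset n → List ℕ
elems = elemsFrom 0

-- t-th entry (1-based) of a list, default 0
nth : List ℕ → ℕ → ℕ
nth xs         zero          = 0
nth []         (suc t)       = 0
nth (x ∷ xs)   (suc zero)    = x
nth (x ∷ xs)   (suc (suc t)) = nth xs (suc t)

sel : ∀ {n} → Subset n → ℕ → ℕ
sel S t = nth (elems S) t

-- 1-based lookup into a Fin-indexed family, default outside range
at : ∀ {m} {A : Set} → (Fin m → A) → A → ℕ → A
at {zero}  f d _             = d
at {suc m} f d zero          = d
at {suc m} f d (suc zero)    = f Fin.zero
at {suc m} f d (suc (suc t)) = at (λ x → f (Fin.suc x)) d (suc t)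

sumℤ : List ℤ → ℤ
sumℤ = foldr _+_ (+ 0)

-- Σ_{t=a}^{b} g t  (zero if a > b)
rangeSum : ℕ → ℕ → (ℕ → ℤ) → ℤ
rangeSum a b g = sumℤ (map (λ d → g (a ℕ.+ d)) (upTo (suc b ∸ a)))

-- The linear functions γ_S on ℝ^{(k-1)×(n-k)} (evaluated on integer points)

Mat : ℕ → ℕ → Set
Mat r c = Fin r → Fin c → ℤ

Coord : ℕ → ℕ → Set
Coord n k = Mat (k ∸ 1) (n ∸ k)

αat : ∀ {r c} → Mat r c → ℕ → ℕ → ℤ
αat α i j = at (λ p → at (α p) (+ 0) j) (+ 0) i

αrange : ∀ {r c} → Mat r c → ℕ → ℕ → ℕ → ℤ
αrange α i a b = rangeSum a b (λ t → αat α i t)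

γ : (n k : ℕ) → Subset n → Coord n k → ℤ
γ n k S α = rangeSum 1 (k ∸ 1)
  (λ i → αrange α i (sel S i ∸ (i ∸ 1)) (sel S (suc i) ∸ i ∸ 1))

_⊕_ : ∀ {r c} → Mat r c → Mat r c → Mat r c
(u ⊕ w) p q = u p q + w p q

zeroV : ∀ {r c} → Mat r c
zeroV p q = + 0

E : ∀ {r c} → ℕ → ℕ → Mat r c
E i j p q = if (suc (toℕ p) ≡ᵇ i) ∧ (suc (toℕ q) ≡ᵇ j) then + 1 else + 0

F : (n k : ℕ) → ℕ → ℕ → Coord n k
F n k i j p q =
  if j <ᵇ (n ∸ k)
  then E i j p q - E i (suc j) p q
  else E i j p q - E i 1 p q

vsum : ∀ {r c} → List (Mat r c) → Mat r c
vsum = foldr _⊕_ zeroV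

Frange : (n k : ℕ) → ℕ → ℕ → ℕ → Coord n k
Frange n k i a b = vsum (map (λ d → F n k i (a ℕ.+ d)) (upTo (suc b ∸ a)))

v : (n k : ℕ) → Subset n → Coord n k
v n k S = vsum (map (λ d → let ℓ = suc d in
                  Frange n k ℓ (sel S ℓ ∸ (ℓ ∸ 1)) (sel S (suc ℓ) ∸ ℓ ∸ 1))
               (upTo (k ∸ 1)))

CyclicOrder : ℕ → ℕ → ℕ → ℕ → Set
CyclicOrder a b c d =
    (a < b × b < c × c < d)
  ⊎ (b < c × c < d × d < a)
  ⊎ (c < d × d < a × a < b)
  ⊎ (d < a × a < b × b < c)

WeaklySeparated : List ℕ → List ℕ → Set
WeaklySeparated A B =
  ¬ (∃[ a ] ∃[ b ] ∃[ c ] ∃[ d ]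
       (CyclicOrder a b c d
        × (a ∈ A × a ∉ B) × (c ∈ A × c ∉ B)
        × (b ∈ B × b ∉ A) × (d ∈ B × d ∉ A)))

SameSet : List ℕ → List ℕ → Set
SameSet X Y = ∀ x → (x ∈ X → x ∈ Y) × (x ∈ Y → x ∈ X)

-- {x_p, ..., x_q} for a sorted list x_1 < x_2 < ... (1-based, empty if p > q)
slice : ℕ → ℕ → List ℕ → List ℕ
slice p q xs = take (suc q ∸ p) (drop (p ∸ 1) xs)

Noncrossing : ∀ {n} → ℕ → Subset n → Subset n → Set
Noncrossing k A B =
  ∀ p q → 1 ℕ.≤ p → p < q → q ℕ.≤ k →
    WeaklySeparated (slice p q (elems A)) (slice p q (elems B))
    ⊎ ¬ SameSet (slice (suc p) (q ∸ 1) (elems A)) (slice (suc p) (q ∸ 1) (elems B))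

IJ : ∀ {n m} → (Fin m → Fin n) → (Fin m → Fin n) → Subset n
IJ {m = m} i j = ⋃ (map (λ a → ⁅ i a ⁆ ∪ ⁅ j a ⁆) (allFin m))

Msel : ∀ {n m} → (Fin m → Fin n) → (Fin m → Fin n) → (Fin m → Bool) → Subset n
Msel {m = m} i j c = ⋃ (map (λ a → ⁅ (if c a then i a else j a) ⁆) (allFin m))

Mbar : ∀ {n m} → (Fin m → Fin n) → (Fin m → Fin n) → (Fin m → Bool) → Subset n
Mbar i j c = IJ i j ─ Msel i j c

-- the alternating choice: i_a for a odd, j_a for a even (a 1-based)
altChoice : ∀ {m} → Fin m → Bool
altChoice a = evenᵇ (toℕ a)
  where
  evenᵇ : ℕ → Bool
  evenᵇ zero          = true
  evenᵇ (suc zero)    = false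
  evenᵇ (suc (suc x)) = evenᵇ x

module Submission where

-- Write S and T for the increasing lists of M ∪ L and M̄ ∪ L.  Cutting at the cube pairs, both
-- are concatenations of the same segments: an element of L outside all intervals [i_a, j_a]
-- sits at the same place in S and in T, while pair a together with the elements xs of L
-- between i_a and j_a contributes i_a xs to one list and xs j_a to the other.  Changing the
-- vertex therefore only exchanges S_t and T_t at some positions t.  The ℓ-th summand of γ_S
-- (and of each entry of v_S) is a difference of partial sums depending on s_ℓ and on s_{ℓ+1}
-- separately, so γ_S + γ_T and v_S + v_T only see the pairs {S_t, T_t}.
--
-- A crossing of two slices of S and T with equal interiors must be formed by their end entries.
-- Inside a block the two lists are shifted copies of each other, and straddling a block of one
-- orientation into the next block of the opposite orientation never interleaves the ends; but
-- two consecutive blocks of equal orientation produce a crossing.  So the pair is noncrossing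
-- exactly when the orientations alternate, that is, when M = M″ or M = M̄″.

open import Defs
open import Data.Bool using (Bool; true; false; not; if_then_else_)
open import Data.Bool.Properties using (not-¬; ⇔→≡)
open import Data.Empty using (⊥; ⊥-elim)
open import Data.Fin as Fin using (Fin; toℕ)
import Data.Fin.Properties as Finₚ
open import Data.Fin.Subset using (Subset; ∣_∣; ⁅_⁆; ⋃; _─_)
  renaming (_∈_ to _∈ˢ_; _∉_ to _∉ˢ_; _∪_ to _∪ˢ_)
import Data.Fin.Subset.Properties as Subsetₚ
open import Data.Integer using (ℤ; +_; _+_)
import Data.Integer.Properties as ℤₚ
open import Algebra.Properties.AbelianGroup ℤₚ.+-0-abelianGroup using (∙-cancelʳ)
open import Algebra.Properties.CommutativeSemigroup ℤₚ.+-commutativeSemigroup using (interchange)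
open import Data.List
  using (List; []; _∷_; _++_; concatMap; length; take; drop; map; filter; tabulate; allFin; upTo; applyUpTo)
open import Data.List.Properties
  using (length-++; ++-assoc; ++-identityʳ; map-cong; concatMap-map; concatMap-cong; length-tabulate; map-applyUpTo)
open import Data.List.Membership.Propositional using (_∈_; _∉_; lose)
open import Data.List.Membership.Propositional.Properties
  using (∈-++⁺ˡ; ∈-++⁺ʳ; ∈-++⁻; ∈-filter⁺; ∈-filter⁻; ∈-tabulate⁺; ∈-tabulate⁻; ∈-allFin)
open import Data.List.Relation.Binary.Pointwise as Pointwise using (Pointwise; []; _∷_)
open import Data.List.Relation.Binary.Sublist.Propositional as Sublist using (_⊆_; []; _∷_; _∷ʳ_; ⊆-refl)
open import Data.List.Relation.Binary.Sublist.Propositional.Properties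
  using (All-resp-⊆; ++⁺; ++⁺ˡ; ++⁺ʳ; []⊆-universal; take-⊆; drop-⊆; filter-⊆)
open import Data.List.Relation.Unary.All as All using (All; []; _∷_)
import Data.List.Relation.Unary.All.Properties as All
open import Data.List.Relation.Unary.AllPairs as AllPairs using (AllPairs; []; _∷_)
open import Data.List.Relation.Unary.Any as Any using (Any; here; there)
import Data.List.Relation.Unary.Any.Properties as Any
open import Data.List.Relation.Unary.Linked as Linked using (Linked; []; [-]; _∷_)
open import Data.Nat using (ℕ; zero; suc; _∸_; _≤_; _<_; _<?_; _≟_; z≤n; s≤s) renaming (_+_ to _+ℕ_)
open import Data.Nat.Properties
open import Data.List.Relation.Binary.Subset.DecPropositional _≟_ using () renaming (_⊆?_ to _⊆ₛ?_)
open import Data.Product as Product using (_×_; _,_; proj₁; proj₂; ∃-syntax)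
open import Data.Sum as Sum using (_⊎_; inj₁; inj₂)
open import Data.Unit using (⊤; tt)
open import Data.Vec using ([]; _∷_; here; there)
open import Function.Base using (_∘_)
open import Function.Bundles using (_⇔_; mk⇔; Equivalence)
open import Function.Properties.Equivalence using () renaming (trans to ⇔-trans)
open import Relation.Binary using (tri<; tri≈; tri>)
open import Relation.Binary.PropositionalEquality
  using (_≡_; _≢_; refl; sym; trans; cong; cong₂; subst; subst₂; module ≡-Reasoning)
open import Relation.Nullary using (¬_; Dec; yes; no)
open import Relation.Nullary.Decidable using (_×-dec_)

-- Sorted lists and 1-based positions

Sorted : List ℕ → Set
Sorted = AllPairs _<_

Sorted-resp-⊆ : ∀ {xs ys} → xs ⊆ ys → Sorted ys → Sorted xs
Sorted-resp-⊆ [] s = s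
Sorted-resp-⊆ (y ∷ʳ τ) (_ ∷ s) = Sorted-resp-⊆ τ s
Sorted-resp-⊆ (refl ∷ τ) (h ∷ s) = All-resp-⊆ τ h ∷ Sorted-resp-⊆ τ s

Sorted-++⁻ʳ : ∀ xs {ys} → Sorted (xs ++ ys) → Sorted ys
Sorted-++⁻ʳ []       s       = s
Sorted-++⁻ʳ (x ∷ xs) (_ ∷ s) = Sorted-++⁻ʳ xs s

Sorted-++⇒< : ∀ xs {ys x y} → Sorted (xs ++ ys) → x ∈ xs → y ∈ ys → x < y
Sorted-++⇒< (x ∷ xs) (h ∷ _) (here refl) y∈ = All.lookup h (∈-++⁺ʳ xs y∈)
Sorted-++⇒< (x ∷ xs) (_ ∷ s) (there x∈) y∈ = Sorted-++⇒< xs s x∈ y∈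

Sorted-++⁺ : ∀ {xs ys} → Sorted xs → Sorted ys → (∀ {x y} → x ∈ xs → y ∈ ys → x < y) →
             Sorted (xs ++ ys)
Sorted-++⁺ {[]}     _       t _   = t
Sorted-++⁺ {x ∷ xs} (h ∷ s) t lt =
  All.tabulate head< ∷ Sorted-++⁺ s t (λ x∈ y∈ → lt (there x∈) y∈)
  where
  head< : ∀ {y} → y ∈ xs ++ _ → x < y
  head< y∈ with ∈-++⁻ xs y∈
  ... | inj₁ y∈xs = All.lookup h y∈xs
  ... | inj₂ y∈ys = lt (here refl) y∈ys

∈-∷⇒∈-tail : ∀ {z zs ws} → All (z <_) zs → (∀ {w} → w ∈ z ∷ zs → w ∈ z ∷ ws) →
              ∀ {w} → w ∈ zs → w ∈ ws
∈-∷⇒∈-tail z<zs f w∈ with f (there w∈)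
... | here refl = ⊥-elim (<-irrefl refl (All.lookup z<zs w∈))
... | there w∈′ = w∈′

Sorted-≡ : ∀ {xs ys} → Sorted xs → Sorted ys →
           (∀ {x} → x ∈ xs → x ∈ ys) → (∀ {x} → x ∈ ys → x ∈ xs) → xs ≡ ys
Sorted-≡ {[]}     {[]}     _ _ _ _ = refl
Sorted-≡ {[]}     {y ∷ ys} _ _ _ g with () ← g (here refl)
Sorted-≡ {x ∷ xs} {[]}     _ _ f _ with () ← f (here refl)
Sorted-≡ {x ∷ xs} {y ∷ ys} (x<xs ∷ sx) (y<ys ∷ sy) f g with heads≡ (f (here refl)) (g (here refl))
  where
  heads≡ : x ∈ y ∷ ys → y ∈ x ∷ xs → x ≡ y
  heads≡ (here x≡y)  _           = x≡y
  heads≡ (there _)   (here y≡x)  = sym y≡x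
  heads≡ (there x∈)  (there y∈)  = ⊥-elim (<-asym (All.lookup y<ys x∈) (All.lookup x<xs y∈))
... | refl = cong (x ∷_) (Sorted-≡ sx sy (∈-∷⇒∈-tail x<xs f) (∈-∷⇒∈-tail y<ys g))

length-snoc : ∀ (xs : List ℕ) y → length (xs ++ y ∷ []) ≡ suc (length xs)
length-snoc xs y = trans (length-++ xs) (+-comm (length xs) 1)

nth-∈ : ∀ xs {u} → 1 ≤ u → u ≤ length xs → nth xs u ∈ xs
nth-∈ (x ∷ xs) {suc zero}    _ _         = here refl
nth-∈ (x ∷ xs) {suc (suc u)} _ (s≤s u≤) = there (nth-∈ xs (s≤s z≤n) u≤)

Sorted-nth-< : ∀ {xs u v} → Sorted xs → 1 ≤ u → u < v → v ≤ length xs → nth xs u < nth xs v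
Sorted-nth-< {x ∷ xs} {suc zero}    {suc (suc v)} (x<xs ∷ _) _ _ (s≤s v≤) =
  All.lookup x<xs (nth-∈ xs (s≤s z≤n) v≤)
Sorted-nth-< {x ∷ xs} {suc zero}    {suc zero}    _ _ (s≤s ()) _
Sorted-nth-< {x ∷ xs} {suc (suc u)} {suc (suc v)} (_ ∷ s) _ (s≤s u<v) (s≤s v≤) =
  Sorted-nth-< s (s≤s z≤n) u<v v≤

nth-++ˡ : ∀ xs ys {u} → 1 ≤ u → u ≤ length xs → nth (xs ++ ys) u ≡ nth xs u
nth-++ˡ (x ∷ xs) ys {suc zero}    _ _         = refl
nth-++ˡ (x ∷ xs) ys {suc (suc u)} _ (s≤s u≤) = nth-++ˡ xs ys (s≤s z≤n) u≤

nth-++ʳ : ∀ xs ys u → nth (xs ++ ys) (length xs +ℕ suc u) ≡ nth ys (suc u)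
nth-++ʳ []       ys u = refl
nth-++ʳ (x ∷ xs) ys u with length xs +ℕ suc u | +-suc (length xs) u | nth-++ʳ xs ys u
... | _ | refl | ih = ih

nth-after : ∀ xs y ys → nth (xs ++ y ∷ ys) (suc (length xs)) ≡ y
nth-after []       y ys = refl
nth-after (x ∷ xs) y ys = nth-after xs y ys

nth-snoc-++ : ∀ xs y ys → nth ((xs ++ y ∷ []) ++ ys) (suc (length xs)) ≡ y
nth-snoc-++ []       y ys = refl
nth-snoc-++ (x ∷ xs) y ys = nth-snoc-++ xs y ys

nth-≥ : ∀ {o xs} → Sorted xs → All (o <_) xs → ∀ {ℓ} → 1 ≤ ℓ → ℓ ≤ length xs → o +ℕ ℓ ≤ nth xs ℓ
nth-≥ {o} {x ∷ xs} _          (o<x ∷ _)   {suc zero}    _ _ = subst (_≤ x) (+-comm 1 o) o<x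
nth-≥ {o} {x ∷ xs} (x<xs ∷ s) (o<x ∷ _)   {suc (suc ℓ)} _ (s≤s ℓ≤) = begin
  o +ℕ suc (suc ℓ) ≡⟨ +-suc o (suc ℓ) ⟩
  suc o +ℕ suc ℓ   ≤⟨ +-monoˡ-≤ (suc ℓ) o<x ⟩
  x +ℕ suc ℓ       ≤⟨ nth-≥ s x<xs (s≤s z≤n) ℓ≤ ⟩
  nth xs (suc ℓ)   ∎
  where open ≤-Reasoning

slice-⊆ : ∀ a b xs → slice a b xs ⊆ xs
slice-⊆ a b xs = Sublist.⊆-trans (take-⊆ (suc b ∸ a) (drop (a ∸ 1) xs)) (drop-⊆ (a ∸ 1) xs)

nth-∈-take : ∀ xs {u b} → 1 ≤ u → u ≤ b → u ≤ length xs → nth xs u ∈ take b xs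
nth-∈-take (x ∷ xs) {suc zero}    {suc b} _ _ _ = here refl
nth-∈-take (x ∷ xs) {suc (suc u)} {suc b} _ (s≤s u≤b) (s≤s u≤) =
  there (nth-∈-take xs (s≤s z≤n) u≤b u≤)

nth-∈-slice : ∀ xs {a u b} → 1 ≤ a → a ≤ u → u ≤ b → u ≤ length xs → nth xs u ∈ slice a b xs
nth-∈-slice xs       {suc zero}    _ a≤u u≤b u≤ = nth-∈-take xs a≤u u≤b u≤
nth-∈-slice (x ∷ xs) {suc (suc a)} {suc (suc u)} {suc b} _ (s≤s a≤u) (s≤s u≤b) (s≤s u≤) =
  nth-∈-slice xs (s≤s z≤n) a≤u u≤b u≤

take-suc : ∀ n xs → suc n ≤ length xs → take (suc n) xs ≡ take n xs ++ nth xs (suc n) ∷ []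
take-suc zero    (x ∷ xs) _         = refl
take-suc (suc n) (x ∷ xs) (s≤s n<) = cong (x ∷_) (take-suc n xs n<)

slice-ends : ∀ xs {p q} → 1 ≤ p → p < q → q ≤ length xs →
             slice p q xs ≡ nth xs p ∷ (slice (suc p) (q ∸ 1) xs ++ nth xs q ∷ [])
slice-ends (x ∷ xs) {suc zero}    {suc (suc q)} _ _           (s≤s q≤) = cong (x ∷_) (take-suc q xs q≤)
slice-ends (x ∷ xs) {suc zero}    {suc zero}    _ (s≤s ())  _
slice-ends (x ∷ xs) {suc (suc p)} {suc (suc q)} _ (s≤s p<q) (s≤s q≤) = slice-ends xs (s≤s z≤n) p<q q≤

slice-∷ : ∀ x xs {a} b → 1 ≤ a → slice (suc a) (suc b) (x ∷ xs) ≡ slice a b xs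
slice-∷ x xs {suc a} b _ = refl

slice-++ʳ : ∀ xs ys {a} b → 1 ≤ a → slice (length xs +ℕ a) (length xs +ℕ b) (xs ++ ys) ≡ slice a b ys
slice-++ʳ []       ys     b _   = refl
slice-++ʳ (x ∷ xs) ys {a} b 1≤a =
  trans (slice-∷ x (xs ++ ys) (length xs +ℕ b) (≤-trans 1≤a (m≤n+m a (length xs))))
        (slice-++ʳ xs ys b 1≤a)

take-++ : ∀ (xs : List ℕ) ys → take (length xs) (xs ++ ys) ≡ xs
take-++ []       ys = refl
take-++ (x ∷ xs) ys = cong (x ∷_) (take-++ xs ys)

slice-++-middle : ∀ xs ys zs → slice (suc (length xs)) (length xs +ℕ length ys) (xs ++ ys ++ zs) ≡ ys
slice-++-middle []       ys zs = take-++ ys zs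
slice-++-middle (x ∷ xs) ys zs = slice-++-middle xs ys zs

-- Crossings of slices

-- WeaklySeparated A B is ¬ Crossing A B by definition.
Crossing : List ℕ → List ℕ → Set
Crossing A B = ∃[ a ] ∃[ b ] ∃[ c ] ∃[ d ]
  (CyclicOrder a b c d
   × (a ∈ A × a ∉ B) × (c ∈ A × c ∉ B)
   × (b ∈ B × b ∉ A) × (d ∈ B × d ∉ A))

CyclicOrder-rotate : ∀ {a b c d} → CyclicOrder a b c d → CyclicOrder b c d a
CyclicOrder-rotate (inj₁ o)                 = inj₂ (inj₂ (inj₂ o))
CyclicOrder-rotate (inj₂ (inj₁ o))          = inj₁ o
CyclicOrder-rotate (inj₂ (inj₂ (inj₁ o)))   = inj₂ (inj₁ o)
CyclicOrder-rotate (inj₂ (inj₂ (inj₂ o)))   = inj₂ (inj₂ (inj₁ o))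

Crossing-sym : ∀ {A B} → Crossing A B → Crossing B A
Crossing-sym (a , b , c , d , o , a∈ , c∈ , b∈ , d∈) =
  b , c , d , a , CyclicOrder-rotate o , b∈ , d∈ , c∈ , a∈

Interleaved : ℕ → ℕ → ℕ → ℕ → Set
Interleaved x₁ y₁ x₂ y₂ = (x₁ < y₁ × y₁ < x₂ × x₂ < y₂) ⊎ (y₁ < x₁ × x₁ < y₂ × y₂ < x₂)

Interleaved-sym : ∀ {x₁ y₁ x₂ y₂} → Interleaved x₁ y₁ x₂ y₂ → Interleaved y₁ x₁ y₂ x₂
Interleaved-sym (inj₁ o) = inj₂ o
Interleaved-sym (inj₂ o) = inj₁ o

Pair : ℕ → ℕ → ℕ → Set
Pair x₁ x₂ a = a ≡ x₁ ⊎ a ≡ x₂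

SamePair : ℕ → ℕ → ℕ → ℕ → Set
SamePair a c x₁ x₂ = (a ≡ x₁ × c ≡ x₂) ⊎ (a ≡ x₂ × c ≡ x₁)

Pair-< : ∀ {x₁ x₂ a c} → x₁ < x₂ → Pair x₁ x₂ a → Pair x₁ x₂ c → a < c → a ≡ x₁ × c ≡ x₂
Pair-< _   (inj₁ refl) (inj₁ refl) a<c = ⊥-elim (<-irrefl refl a<c)
Pair-< _   (inj₁ refl) (inj₂ refl) _   = refl , refl
Pair-< x<x (inj₂ refl) (inj₁ refl) a<c = ⊥-elim (<-asym x<x a<c)
Pair-< _   (inj₂ refl) (inj₂ refl) a<c = ⊥-elim (<-irrefl refl a<c)

CyclicOrder⇒Interleaved :
  ∀ {x₁ x₂ y₁ y₂ a b c d} → x₁ < x₂ → y₁ < y₂ →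
  Pair x₁ x₂ a → Pair y₁ y₂ b → Pair x₁ x₂ c → Pair y₁ y₂ d → CyclicOrder a b c d →
  Interleaved x₁ y₁ x₂ y₂ × SamePair a c x₁ x₂ × SamePair b d y₁ y₂
CyclicOrder⇒Interleaved x< y< a b c d (inj₁ (a<b , b<c , c<d))
  with refl , refl ← Pair-< x< a c (<-trans a<b b<c) | refl , refl ← Pair-< y< b d (<-trans b<c c<d)
  = inj₁ (a<b , b<c , c<d) , inj₁ (refl , refl) , inj₁ (refl , refl)
CyclicOrder⇒Interleaved x< y< a b c d (inj₂ (inj₁ (b<c , c<d , d<a)))
  with refl , refl ← Pair-< x< c a (<-trans c<d d<a) | refl , refl ← Pair-< y< b d (<-trans b<c c<d)
  = inj₂ (b<c , c<d , d<a) , inj₂ (refl , refl) , inj₁ (refl , refl)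
CyclicOrder⇒Interleaved x< y< a b c d (inj₂ (inj₂ (inj₁ (c<d , d<a , a<b))))
  with refl , refl ← Pair-< x< c a (<-trans c<d d<a) | refl , refl ← Pair-< y< d b (<-trans d<a a<b)
  = inj₁ (c<d , d<a , a<b) , inj₂ (refl , refl) , inj₂ (refl , refl)
CyclicOrder⇒Interleaved x< y< a b c d (inj₂ (inj₂ (inj₂ (d<a , a<b , b<c))))
  with refl , refl ← Pair-< x< a c (<-trans a<b b<c) | refl , refl ← Pair-< y< d b (<-trans d<a a<b)
  = inj₂ (d<a , a<b , b<c) , inj₁ (refl , refl) , inj₂ (refl , refl)

SamePair⇒∉ : ∀ {a c x₁ x₂ B} → a ∉ B → c ∉ B → SamePair a c x₁ x₂ → x₁ ∉ B × x₂ ∉ B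
SamePair⇒∉ a∉ c∉ (inj₁ (refl , refl)) = a∉ , c∉
SamePair⇒∉ a∉ c∉ (inj₂ (refl , refl)) = c∉ , a∉

∈-ends : ∀ {a} x I y → a ∈ x ∷ (I ++ y ∷ []) → a ∉ I → Pair x y a
∈-ends x I y (here a≡x) _ = inj₁ a≡x
∈-ends x I y (there a∈) a∉I with ∈-++⁻ I a∈
... | inj₁ a∈I        = ⊥-elim (a∉I a∈I)
... | inj₂ (here a≡y) = inj₂ a≡y

-- S° and T° stand for the elements private to S and to T.  An end-crossing is what a crossing of
-- the slices [p, q] with equal interiors amounts to.
record EndCrossing (S T S° T° : List ℕ) (p q : ℕ) : Set where
  field
    Sq≢T : ∀ u → p ≤ u → u ≤ q → nth S q ≢ nth T u
    Tq≢S : ∀ u → p ≤ u → u ≤ q → nth T q ≢ nth S u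
    Sp≢T : ∀ u → p ≤ u → u ≤ q → nth S p ≢ nth T u
    Tp≢S : ∀ u → p ≤ u → u ≤ q → nth T p ≢ nth S u
    S-interior∉ : ∀ u → p < u → u < q → nth S u ∉ S°
    T-interior∉ : ∀ u → p < u → u < q → nth T u ∉ T°
    ends-interleaved : Interleaved (nth S p) (nth T p) (nth S q) (nth T q)

EndCrossing-sym : ∀ {S T S° T° p q} → EndCrossing S T S° T° p q → EndCrossing T S T° S° p q
EndCrossing-sym c = record
  { Sq≢T = Tq≢S ; Tq≢S = Sq≢T ; Sp≢T = Tp≢S ; Tp≢S = Sp≢T
  ; S-interior∉ = T-interior∉ ; T-interior∉ = S-interior∉
  ; ends-interleaved = Interleaved-sym ends-interleaved }
  where open EndCrossing c

EndCrossing-cong : ∀ {S S′ T T′ S° S°′ T° T°′ p q} → S ≡ S′ → T ≡ T′ → S° ≡ S°′ → T° ≡ T°′ →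
                   EndCrossing S T S° T° p q → EndCrossing S′ T′ S°′ T°′ p q
EndCrossing-cong refl refl refl refl c = c

crossing⇒interleaved-ends :
  ∀ {S T p q} → Sorted S → Sorted T → 1 ≤ p → p < q → q ≤ length S → q ≤ length T →
  SameSet (slice (suc p) (q ∸ 1) S) (slice (suc p) (q ∸ 1) T) →
  Crossing (slice p q S) (slice p q T) →
  Interleaved (nth S p) (nth T p) (nth S q) (nth T q)
  × (nth S p ∉ slice p q T × nth S q ∉ slice p q T) × (nth T p ∉ slice p q S × nth T q ∉ slice p q S)
crossing⇒interleaved-ends {S} {T} {p} {q} sS sT 1≤p p<q q≤S q≤T same
                          (a , b , c , d , o , (a∈A , a∉B) , (c∈A , c∉B) , (b∈B , b∉A) , (d∈B , d∉A))
  = conclude (CyclicOrder⇒Interleaved (Sorted-nth-< sS 1≤p p<q q≤S) (Sorted-nth-< sT 1≤p p<q q≤T)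
               (A-end a∈A a∉B) (B-end b∈B b∉A) (A-end c∈A c∉B) (B-end d∈B d∉A) o)
  where
  A = slice p q S
  B = slice p q T
  A≡ : A ≡ nth S p ∷ (slice (suc p) (q ∸ 1) S ++ nth S q ∷ [])
  A≡ = slice-ends S 1≤p p<q q≤S
  B≡ : B ≡ nth T p ∷ (slice (suc p) (q ∸ 1) T ++ nth T q ∷ [])
  B≡ = slice-ends T 1≤p p<q q≤T
  A-end : ∀ {x} → x ∈ A → x ∉ B → Pair (nth S p) (nth S q) x
  A-end x∈ x∉ = ∈-ends _ _ _ (subst (_ ∈_) A≡ x∈)
    (λ x∈IA → x∉ (subst (_ ∈_) (sym B≡) (there (∈-++⁺ˡ (proj₁ (same _) x∈IA)))))
  B-end : ∀ {x} → x ∈ B → x ∉ A → Pair (nth T p) (nth T q) x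
  B-end x∈ x∉ = ∈-ends _ _ _ (subst (_ ∈_) B≡ x∈)
    (λ x∈IB → x∉ (subst (_ ∈_) (sym A≡) (there (∈-++⁺ˡ (proj₂ (same _) x∈IB)))))
  conclude : Interleaved (nth S p) (nth T p) (nth S q) (nth T q) × SamePair a c (nth S p) (nth S q)
             × SamePair b d (nth T p) (nth T q) →
             Interleaved (nth S p) (nth T p) (nth S q) (nth T q) × (nth S p ∉ B × nth S q ∉ B) × (nth T p ∉ A × nth T q ∉ A)
  conclude (ends , ac , bd) = ends , SamePair⇒∉ a∉B c∉B ac , SamePair⇒∉ b∉A d∉A bd

crossing⇒EndCrossing :
  ∀ {S T S° T° p q} → Sorted S → Sorted T →
  (∀ {x} → x ∈ T → x ∉ S°) → (∀ {x} → x ∈ S → x ∉ T°) →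
  1 ≤ p → p < q → q ≤ length S → q ≤ length T →
  SameSet (slice (suc p) (q ∸ 1) S) (slice (suc p) (q ∸ 1) T) →
  Crossing (slice p q S) (slice p q T) → EndCrossing S T S° T° p q
crossing⇒EndCrossing {S} {T} {S°} {T°} {p} {q} sS sT T∌S° S∌T° 1≤p p<q q≤S q≤T same crossing
  with ends , (Sp∉B , Sq∉B) , (Tp∉A , Tq∉A) ← crossing⇒interleaved-ends sS sT 1≤p p<q q≤S q≤T same crossing
  = record
    { Sq≢T = λ u p≤u u≤q e → Sq∉B (subst (_∈ _) (sym e) (∈-slice T p≤u u≤q q≤T))
    ; Tq≢S = λ u p≤u u≤q e → Tq∉A (subst (_∈ _) (sym e) (∈-slice S p≤u u≤q q≤S))
    ; Sp≢T = λ u p≤u u≤q e → Sp∉B (subst (_∈ _) (sym e) (∈-slice T p≤u u≤q q≤T))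
    ; Tp≢S = λ u p≤u u≤q e → Tp∉A (subst (_∈ _) (sym e) (∈-slice S p≤u u≤q q≤S))
    ; S-interior∉ = λ u p<u u<q → T∌S° (Sublist.lookup (slice-⊆ (suc p) (q ∸ 1) T)
                      (proj₁ (same _) (∈-interior S p<u u<q q≤S)))
    ; T-interior∉ = λ u p<u u<q → S∌T° (Sublist.lookup (slice-⊆ (suc p) (q ∸ 1) S)
                      (proj₂ (same _) (∈-interior T p<u u<q q≤T)))
    ; ends-interleaved = ends }
  where
  ∈-slice : ∀ X {u} → p ≤ u → u ≤ q → q ≤ length X → nth X u ∈ slice p q X
  ∈-slice X p≤u u≤q q≤X = nth-∈-slice X 1≤p p≤u u≤q (≤-trans u≤q q≤X)
  ∈-interior : ∀ X {u} → p < u → u < q → q ≤ length X → nth X u ∈ slice (suc p) (q ∸ 1) X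
  ∈-interior X p<u u<q q≤X = nth-∈-slice X (s≤s z≤n) p<u (∸-monoˡ-≤ 1 u<q) (<⇒≤ (<-≤-trans u<q q≤X))

-- Segments and orientations

-- A block (i, xs, j) of a vertex pair consists of a cube pair {i, j} together with the fixed
-- elements xs strictly between them; orientation true puts i into the first set and j into the second.
data Segment : Set where
  single : ℕ → Segment
  block  : Bool → ℕ → List ℕ → ℕ → Segment

segS segT segAll ownS ownT : Segment → List ℕ
segS (single x)            = x ∷ []
segS (block true  i xs j)  = i ∷ xs
segS (block false i xs j)  = xs ++ j ∷ []
segT (single x)            = x ∷ []
segT (block true  i xs j)  = xs ++ j ∷ []
segT (block false i xs j)  = i ∷ xs
segAll (single x)          = x ∷ []
segAll (block _ i xs j)    = i ∷ (xs ++ j ∷ [])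
ownS (single x)            = []
ownS (block true  i _ j)   = i ∷ []
ownS (block false i _ j)   = j ∷ []
ownT (single x)            = []
ownT (block true  i _ j)   = j ∷ []
ownT (block false i _ j)   = i ∷ []

flatS flatT flatAll OwnS OwnT : List Segment → List ℕ
flatS   = concatMap segS
flatT   = concatMap segT
flatAll = concatMap segAll
OwnS    = concatMap ownS
OwnT    = concatMap ownT

flip : Segment → Segment
flip (single x)       = single x
flip (block c i xs j) = block (not c) i xs j

orientations : List Segment → List Bool
orientations []                     = []
orientations (single _ ∷ os)        = orientations os
orientations (block c _ _ _ ∷ os)   = c ∷ orientations os

Alternating : List Bool → Set
Alternating = Linked (λ b c → c ≡ not b)

FirstOrientation : Bool → List Segment → Set
FirstOrientation b []                   = ⊤
FirstOrientation b (single _ ∷ os)      = FirstOrientation b os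
FirstOrientation b (block c _ _ _ ∷ os) = c ≡ b

concatMap-⊆ : ∀ {A : Set} {f g : A → List ℕ} → (∀ a → f a ⊆ g a) → ∀ as → concatMap f as ⊆ concatMap g as
concatMap-⊆ f⊆g []       = []
concatMap-⊆ f⊆g (a ∷ as) = ++⁺ (f⊆g a) (concatMap-⊆ f⊆g as)

segS⊆segAll : ∀ o → segS o ⊆ segAll o
segS⊆segAll (single x)           = ⊆-refl
segS⊆segAll (block true  i xs j) = refl ∷ ++⁺ʳ (j ∷ []) ⊆-refl
segS⊆segAll (block false i xs j) = i ∷ʳ ⊆-refl

segT⊆segAll : ∀ o → segT o ⊆ segAll o
segT⊆segAll (single x)           = ⊆-refl
segT⊆segAll (block true  i xs j) = i ∷ʳ ⊆-refl
segT⊆segAll (block false i xs j) = refl ∷ ++⁺ʳ (j ∷ []) ⊆-refl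

ownS⊆segAll : ∀ o → ownS o ⊆ segAll o
ownS⊆segAll (single x)           = []⊆-universal _
ownS⊆segAll (block true  i xs j) = refl ∷ []⊆-universal _
ownS⊆segAll (block false i xs j) = i ∷ʳ ++⁺ˡ xs ⊆-refl

flatS⊆flatAll : ∀ os → flatS os ⊆ flatAll os
flatS⊆flatAll = concatMap-⊆ segS⊆segAll

flatT⊆flatAll : ∀ os → flatT os ⊆ flatAll os
flatT⊆flatAll = concatMap-⊆ segT⊆segAll

segS-flip : ∀ o → segS (flip o) ≡ segT o
segS-flip (single x)           = refl
segS-flip (block true  i xs j) = refl
segS-flip (block false i xs j) = refl

segT-flip : ∀ o → segT (flip o) ≡ segS o
segT-flip (single x)           = refl
segT-flip (block true  i xs j) = refl
segT-flip (block false i xs j) = refl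

segAll-flip : ∀ o → segAll (flip o) ≡ segAll o
segAll-flip (single x)       = refl
segAll-flip (block c i xs j) = refl

ownS-flip : ∀ o → ownS (flip o) ≡ ownT o
ownS-flip (single x)           = refl
ownS-flip (block true  i xs j) = refl
ownS-flip (block false i xs j) = refl

ownT-flip : ∀ o → ownT (flip o) ≡ ownS o
ownT-flip (single x)           = refl
ownT-flip (block true  i xs j) = refl
ownT-flip (block false i xs j) = refl

concatMap-flip : ∀ {f g : Segment → List ℕ} → (∀ o → f (flip o) ≡ g o) →
                 ∀ os → concatMap f (map flip os) ≡ concatMap g os
concatMap-flip {f} f∘flip≡g os = trans (concatMap-map f flip os) (concatMap-cong f∘flip≡g os)

length-segS : ∀ o → length (segS o) ≡ length (segT o)
length-segS (single x)           = refl
length-segS (block true  i xs j) = sym (length-snoc xs j)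
length-segS (block false i xs j) = length-snoc xs j

length-flatS : ∀ os → length (flatS os) ≡ length (flatT os)
length-flatS []       = refl
length-flatS (o ∷ os) = begin
  length (segS o ++ flatS os)               ≡⟨ length-++ (segS o) ⟩
  length (segS o) +ℕ length (flatS os)      ≡⟨ cong₂ _+ℕ_ (length-segS o) (length-flatS os) ⟩
  length (segT o) +ℕ length (flatT os)      ≡⟨ length-++ (segT o) ⟨
  length (segT o ++ flatT os)               ∎
  where open ≡-Reasoning

FirstOrientation-flip : ∀ {b} os → FirstOrientation b os → FirstOrientation (not b) (map flip os)
FirstOrientation-flip []                     _    = tt
FirstOrientation-flip (single _ ∷ os)        f    = FirstOrientation-flip os f
FirstOrientation-flip (block c _ _ _ ∷ os)   refl = refl

Alternating⇒FirstOrientation : ∀ c os → Alternating (c ∷ orientations os) → FirstOrientation (not c) os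
Alternating⇒FirstOrientation c []                     _       = tt
Alternating⇒FirstOrientation c (single _ ∷ os)        a       = Alternating⇒FirstOrientation c os a
Alternating⇒FirstOrientation c (block d _ _ _ ∷ os)   (e ∷ _) = e

segT∩ownS=∅ : ∀ o {x} → Sorted (segAll o) → x ∈ segT o → x ∉ ownS o
segT∩ownS=∅ (block true  i xs j) (i<xs ∷ _) x∈ (here refl) =
  <-irrefl refl (All.lookup i<xs x∈)
segT∩ownS=∅ (block false i xs j) s          x∈ (here refl) =
  <-irrefl refl (Sorted-++⇒< (i ∷ xs) s x∈ (here refl))

flatT∩OwnS=∅ : ∀ os {x} → Sorted (flatAll os) → x ∈ flatT os → x ∉ OwnS os
flatT∩OwnS=∅ (o ∷ os) s x∈T x∈O with ∈-++⁻ (segT o) x∈T | ∈-++⁻ (ownS o) x∈O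
... | inj₁ x∈t | inj₁ x∈o = segT∩ownS=∅ o (Sorted-resp-⊆ (++⁺ʳ _ ⊆-refl) s) x∈t x∈o
... | inj₁ x∈t | inj₂ x∈O′ = <-irrefl refl (Sorted-++⇒< (segAll o) s
                               (Sublist.lookup (segT⊆segAll o) x∈t)
                               (Sublist.lookup (concatMap-⊆ ownS⊆segAll os) x∈O′))
... | inj₂ x∈T′ | inj₁ x∈o = <-irrefl refl (Sorted-++⇒< (segAll o) s
                               (Sublist.lookup (ownS⊆segAll o) x∈o)
                               (Sublist.lookup (flatT⊆flatAll os) x∈T′))
... | inj₂ x∈T′ | inj₂ x∈O′ = flatT∩OwnS=∅ os (Sorted-++⁻ʳ (segAll o) s) x∈T′ x∈O′

flatS∩OwnT=∅ : ∀ os {x} → Sorted (flatAll os) → x ∈ flatS os → x ∉ OwnT os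
flatS∩OwnT=∅ os {x} s x∈S x∈O =
  flatT∩OwnS=∅ (map flip os)
    (subst Sorted (sym (concatMap-flip segAll-flip os)) s)
    (subst (x ∈_) (sym (concatMap-flip segT-flip os)) x∈S)
    (subst (x ∈_) (sym (concatMap-flip ownS-flip os)) x∈O)

EndCrossing-++⁻ : ∀ X Y {R R′ SX SR TY TR} p q → length Y ≡ length X →
  EndCrossing (X ++ R) (Y ++ R′) (SX ++ SR) (TY ++ TR) (length X +ℕ suc p) (length X +ℕ suc q) →
  EndCrossing R R′ SR TR (suc p) (suc q)
EndCrossing-++⁻ X Y {R} {R′} {SX} {SR} {TY} {TR} p q |Y|≡|X| c = record
  { Sq≢T = S≢T Sq≢T ; Tq≢S = T≢S Tq≢S ; Sp≢T = S≢T Sp≢T ; Tp≢S = T≢S Tp≢S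
  ; S-interior∉ = λ { (suc u) p<u u<q x∈ → S-interior∉ (ℓ +ℕ suc u) (+-monoʳ-< ℓ p<u) (+-monoʳ-< ℓ u<q)
                        (subst (_∈ SX ++ SR) (sym (nX u)) (∈-++⁺ʳ SX x∈)) }
  ; T-interior∉ = λ { (suc u) p<u u<q x∈ → T-interior∉ (ℓ +ℕ suc u) (+-monoʳ-< ℓ p<u) (+-monoʳ-< ℓ u<q)
                        (subst (_∈ TY ++ TR) (sym (nY u)) (∈-++⁺ʳ TY x∈)) }
  ; ends-interleaved = subst-Interleaved (nX p) (nY p) (nX q) (nY q) ends-interleaved }
  where
  open EndCrossing c
  ℓ = length X
  shift≤ : ∀ {a b} → a ≤ b → ℓ +ℕ a ≤ ℓ +ℕ b
  shift≤ = +-monoʳ-≤ ℓ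
  nX : ∀ u → nth (X ++ R) (ℓ +ℕ suc u) ≡ nth R (suc u)
  nX = nth-++ʳ X R
  nY : ∀ u → nth (Y ++ R′) (ℓ +ℕ suc u) ≡ nth R′ (suc u)
  nY u = subst (λ t → nth (Y ++ R′) (t +ℕ suc u) ≡ nth R′ (suc u)) |Y|≡|X| (nth-++ʳ Y R′ u)
  S≢T : ∀ {a} → (∀ u → ℓ +ℕ suc p ≤ u → u ≤ ℓ +ℕ suc q → nth (X ++ R) (ℓ +ℕ suc a) ≢ nth (Y ++ R′) u) →
        ∀ u → suc p ≤ u → u ≤ suc q → nth R (suc a) ≢ nth R′ u
  S≢T {a} h (suc u) p≤u u≤q e = h (ℓ +ℕ suc u) (shift≤ p≤u) (shift≤ u≤q) (trans (nX a) (trans e (sym (nY u))))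
  T≢S : ∀ {a} → (∀ u → ℓ +ℕ suc p ≤ u → u ≤ ℓ +ℕ suc q → nth (Y ++ R′) (ℓ +ℕ suc a) ≢ nth (X ++ R) u) →
        ∀ u → suc p ≤ u → u ≤ suc q → nth R′ (suc a) ≢ nth R u
  T≢S {a} h (suc u) p≤u u≤q e = h (ℓ +ℕ suc u) (shift≤ p≤u) (shift≤ u≤q) (trans (nY a) (trans e (sym (nX u))))
  subst-Interleaved : ∀ {a a′ b b′ c c′ d d′} → a ≡ a′ → b ≡ b′ → c ≡ c′ → d ≡ d′ →
                      Interleaved a b c d → Interleaved a′ b′ c′ d′
  subst-Interleaved refl refl refl refl o = o

nth-flatT≤nth-flatS :
  ∀ os {q} → Sorted (flatAll os) → FirstOrientation false os → 1 ≤ q → q ≤ length (flatS os) →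
  (∀ u → 1 ≤ u → u < q → nth (flatT os) u ∉ OwnT os) → nth (flatT os) q ≤ nth (flatS os) q
nth-flatT≤nth-flatS (single y ∷ os) {suc zero}    _ _ _ _ _ = ≤-refl
nth-flatT≤nth-flatS (single y ∷ os) {suc (suc q)} (_ ∷ s) f _ (s≤s q≤) no-own =
  nth-flatT≤nth-flatS os s f (s≤s z≤n) q≤
    (λ { (suc u) _ (s≤s u<q) → no-own (suc (suc u)) (s≤s z≤n) (s≤s (s≤s u<q)) })
nth-flatT≤nth-flatS (block false i xs j ∷ os) {suc zero} (i<rest ∷ _) _ _ 1≤ _ =
  <⇒≤ (All.lookup i<rest (Sublist.lookup (++⁺ ⊆-refl (flatS⊆flatAll os)) (nth-∈ _ (s≤s z≤n) 1≤)))
nth-flatT≤nth-flatS (block false i xs j ∷ os) {suc (suc q)} _ _ _ _ no-own =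
  ⊥-elim (no-own 1 (s≤s z≤n) (s≤s (s≤s z≤n)) (here refl))

private
  TrueBlockCrossing : ℕ → List ℕ → ℕ → List Segment → ℕ → ℕ → Set
  TrueBlockCrossing i xs j os =
    EndCrossing (i ∷ (xs ++ flatS os)) ((xs ++ j ∷ []) ++ flatT os) (i ∷ OwnS os) (j ∷ OwnT os)

-- Inside the block, S is T shifted by one place, so S_q reappears in T at position q - 1.
true-block-crossing-within : ∀ i xs j os {p q} → 1 ≤ p → p < q → q ≤ suc (length xs) →
                             ¬ TrueBlockCrossing i xs j os p q
true-block-crossing-within i xs j os {suc p} {suc (suc q)} _ (s≤s p≤q) (s≤s q≤) c =
  Sq≢T (suc q) p≤q (n≤1+n _) (begin
    nth (xs ++ flatS os) (suc q)                  ≡⟨ nth-++ˡ xs _ (s≤s z≤n) q≤ ⟩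
    nth xs (suc q)                                ≡⟨ nth-++ˡ xs (j ∷ []) (s≤s z≤n) q≤ ⟨
    nth (xs ++ j ∷ []) (suc q)                    ≡⟨ nth-++ˡ (xs ++ j ∷ []) _ (s≤s z≤n) q≤′ ⟨
    nth ((xs ++ j ∷ []) ++ flatT os) (suc q)      ∎)
  where
  open EndCrossing c
  open ≡-Reasoning
  q≤′ : suc q ≤ length (xs ++ j ∷ [])
  q≤′ = ≤-trans q≤ (≤-trans (n≤1+n _) (≤-reflexive (sym (length-snoc xs j))))

<⇒≡+suc : ∀ {l p} → l < p → ∃[ p′ ] p ≡ l +ℕ suc p′
<⇒≡+suc {zero}  {suc p} _         = p , refl
<⇒≡+suc {suc l} {suc p} (s≤s l<p) with p′ , refl ← <⇒≡+suc l<p = p′ , refl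

-- At the last place of the block S has the smaller entry, so interleaving forces S_q < T_q;
-- but the next block is oriented the other way, which makes T_q ≤ S_q.
true-block-crossing-from-end :
  ∀ i xs j os {q} → Sorted (i ∷ ((xs ++ j ∷ []) ++ flatAll os)) → FirstOrientation false os →
  suc (length xs) < q → q ≤ length (i ∷ (xs ++ flatS os)) →
  ¬ TrueBlockCrossing i xs j os (suc (length xs)) q
true-block-crossing-from-end i xs j os s f r<q q≤ c with q′ , refl ← <⇒≡+suc r<q =
  not-interleaved ends-interleaved
  where
  open EndCrossing c
  r = length xs
  S = i ∷ (xs ++ flatS os)
  T = (xs ++ j ∷ []) ++ flatT os
  s′ : Sorted ((i ∷ xs) ++ (j ∷ []) ++ flatAll os)
  s′ = subst (λ zs → Sorted (i ∷ zs)) (++-assoc xs (j ∷ []) (flatAll os)) s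
  Sp<Tp : nth S (suc r) < nth T (suc r)
  Sp<Tp = subst₂ _<_ (sym (nth-++ˡ (i ∷ xs) _ (s≤s z≤n) ≤-refl)) (sym (nth-snoc-++ xs j _))
            (Sorted-++⇒< (i ∷ xs) s′ (nth-∈ (i ∷ xs) (s≤s z≤n) ≤-refl) (here refl))
  Tq≡ : ∀ u → nth T (suc r +ℕ suc u) ≡ nth (flatT os) (suc u)
  Tq≡ u = subst (λ t → nth T (t +ℕ suc u) ≡ _) (length-snoc xs j) (nth-++ʳ (xs ++ j ∷ []) (flatT os) u)
  Sq≡ : nth S (suc r +ℕ suc q′) ≡ nth (flatS os) (suc q′)
  Sq≡ = nth-++ʳ (i ∷ xs) (flatS os) q′
  q′≤ : suc q′ ≤ length (flatS os)
  q′≤ = +-cancelˡ-≤ (suc r) _ _ (subst (suc r +ℕ suc q′ ≤_) (cong suc (length-++ xs)) q≤)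
  no-own : ∀ u → 1 ≤ u → u < suc q′ → nth (flatT os) u ∉ OwnT os
  no-own (suc u) _ u<q x∈ =
    T-interior∉ (suc r +ℕ suc u) (m<m+n (suc r) (s≤s z≤n)) (+-monoʳ-< (suc r) u<q)
      (there (subst (_∈ OwnT os) (sym (Tq≡ u)) x∈))
  not-interleaved : ¬ Interleaved (nth S (suc r)) (nth T (suc r)) (nth S (suc r +ℕ suc q′)) (nth T (suc r +ℕ suc q′))
  not-interleaved (inj₂ (Tp<Sp , _)) = <-asym Tp<Sp Sp<Tp
  not-interleaved (inj₁ (_ , _ , Sq<Tq)) =
    <⇒≱ (subst₂ _<_ Sq≡ (Tq≡ q′) Sq<Tq)
        (nth-flatT≤nth-flatS os (Sorted-++⁻ʳ (i ∷ xs ++ j ∷ []) s) f (s≤s z≤n) q′≤ no-own)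

true-block-no-crossing :
  ∀ i xs j os {p q} → Sorted (i ∷ ((xs ++ j ∷ []) ++ flatAll os)) → FirstOrientation false os →
  1 ≤ p → p ≤ suc (length xs) → p < q → q ≤ length (i ∷ (xs ++ flatS os)) →
  ¬ TrueBlockCrossing i xs j os p q
true-block-no-crossing i xs j os {p} {q} s f 1≤p p≤ p<q q≤ c with m≤n⇒m<n∨m≡n p≤
... | inj₂ refl = true-block-crossing-from-end i xs j os s f p<q q≤ c
... | inj₁ p<r with suc (length xs) <? q
...   | no  r≮q = true-block-crossing-within i xs j os 1≤p p<q (≮⇒≥ r≮q) c
...   | yes r<q = EndCrossing.T-interior∉ c (suc (length xs)) p<r r<q
                    (subst (_∈ j ∷ OwnT os) (sym (nth-snoc-++ xs j _)) (here refl))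

false-block-no-crossing :
  ∀ i xs j os {p q} → Sorted (i ∷ ((xs ++ j ∷ []) ++ flatAll os)) → FirstOrientation true os →
  1 ≤ p → p ≤ suc (length xs) → p < q → q ≤ length (i ∷ (xs ++ flatT os)) →
  ¬ EndCrossing ((xs ++ j ∷ []) ++ flatS os) (i ∷ (xs ++ flatT os)) (j ∷ OwnS os) (i ∷ OwnT os) p q
false-block-no-crossing i xs j os s f 1≤p p≤ p<q q≤ c =
  true-block-no-crossing i xs j (map flip os)
    (subst (λ zs → Sorted (i ∷ ((xs ++ j ∷ []) ++ zs))) (sym (concatMap-flip segAll-flip os)) s)
    (FirstOrientation-flip os f) 1≤p p≤ p<q
    (subst (λ zs → _ ≤ length (i ∷ (xs ++ zs))) (sym (concatMap-flip segS-flip os)) q≤)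
    (EndCrossing-cong (cong (λ zs → i ∷ (xs ++ zs)) (sym (concatMap-flip segS-flip os)))
                      (cong ((xs ++ j ∷ []) ++_) (sym (concatMap-flip segT-flip os)))
                      (cong (i ∷_) (sym (concatMap-flip ownS-flip os)))
                      (cong (j ∷_) (sym (concatMap-flip ownT-flip os)))
                      (EndCrossing-sym c))

Alternating-tail : ∀ o os → Alternating (orientations (o ∷ os)) → Alternating (orientations os)
Alternating-tail (single _)       os a = a
Alternating-tail (block _ _ _ _)  os a = Linked.tail a

no-EndCrossing : ∀ os {p q} → Sorted (flatAll os) → Alternating (orientations os) →
                 1 ≤ p → p < q → q ≤ length (flatS os) →
                 ¬ EndCrossing (flatS os) (flatT os) (OwnS os) (OwnT os) p q
no-EndCrossing [] _ _ _ (s≤s _) () _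
no-EndCrossing (o ∷ os) {p} {q} s a 1≤p p<q q≤ c with length (segS o) <? p
... | yes ℓ<p with p′ , refl ← <⇒≡+suc ℓ<p | q′ , refl ← <⇒≡+suc (<-trans ℓ<p p<q) =
  no-EndCrossing os (Sorted-++⁻ʳ (segAll o) s) (Alternating-tail o os a) (s≤s z≤n)
    (+-cancelˡ-< ℓ _ _ p<q)
    (+-cancelˡ-≤ ℓ _ _ (subst (ℓ +ℕ suc q′ ≤_) (length-++ (segS o)) q≤))
    (EndCrossing-++⁻ (segS o) (segT o) p′ q′ (sym (length-segS o)) c)
  where ℓ = length (segS o)
no-EndCrossing (single x ∷ os) {suc zero} s a 1≤p p<q q≤ c | no _ =
  EndCrossing.Sp≢T c 1 ≤-refl (<⇒≤ p<q) refl
no-EndCrossing (single x ∷ os) {suc (suc p)} s a 1≤p p<q q≤ c | no ℓ≮p = ℓ≮p (s≤s (s≤s z≤n))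
no-EndCrossing (block true i xs j ∷ os) s a 1≤p p<q q≤ c | no ℓ≮p =
  true-block-no-crossing i xs j os s (Alternating⇒FirstOrientation true os a) 1≤p (≮⇒≥ ℓ≮p) p<q q≤ c
no-EndCrossing (block false i xs j ∷ os) {p} {q} s a 1≤p p<q q≤ c | no ℓ≮p =
  false-block-no-crossing i xs j os s (Alternating⇒FirstOrientation false os a) 1≤p
    (subst (p ≤_) (length-snoc xs j) (≮⇒≥ ℓ≮p)) p<q
    (subst (q ≤_) (length-flatS (block false i xs j ∷ os)) q≤) c

-- Noncrossing segment lists

SameSet? : ∀ X Y → Dec (SameSet X Y)
SameSet? X Y with X ⊆ₛ? Y | Y ⊆ₛ? X
... | yes X⊆Y | yes Y⊆X = yes (λ _ → X⊆Y , Y⊆X)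
... | no  X⊈Y | _       = no (λ same → X⊈Y (proj₁ (same _)))
... | yes _   | no  Y⊈X = no (λ same → Y⊈X (proj₂ (same _)))

-- Noncrossing k A B is NoncrossingList k (elems A) (elems B) by definition.
NoncrossingList : ℕ → List ℕ → List ℕ → Set
NoncrossingList k S T = ∀ p q → 1 ≤ p → p < q → q ≤ k →
  WeaklySeparated (slice p q S) (slice p q T)
  ⊎ ¬ SameSet (slice (suc p) (q ∸ 1) S) (slice (suc p) (q ∸ 1) T)

alternating⇒noncrossing : ∀ os → Sorted (flatAll os) → Alternating (orientations os) →
                          NoncrossingList (length (flatS os)) (flatS os) (flatT os)
alternating⇒noncrossing os s a p q 1≤p p<q q≤
  with SameSet? (slice (suc p) (q ∸ 1) (flatS os)) (slice (suc p) (q ∸ 1) (flatT os))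
... | no  ¬same = inj₂ ¬same
... | yes same  = inj₁ λ crossing → no-EndCrossing os s a 1≤p p<q q≤
  (crossing⇒EndCrossing (Sorted-resp-⊆ (flatS⊆flatAll os) s) (Sorted-resp-⊆ (flatT⊆flatAll os) s)
     (flatT∩OwnS=∅ os s) (flatS∩OwnT=∅ os s) 1≤p p<q q≤ (subst (q ≤_) (length-flatS os) q≤)
     same crossing)

NoncrossingList-sym : ∀ {k S T} → NoncrossingList k S T → NoncrossingList k T S
NoncrossingList-sym nc p q 1≤p p<q q≤k with nc p q 1≤p p<q q≤k
... | inj₁ ws    = inj₁ (λ crossing → ws (Crossing-sym crossing))
... | inj₂ ¬same = inj₂ (λ same → ¬same (λ x → proj₂ (same x) , proj₁ (same x)))

slice-interior-++ʳ : ∀ xs ys {p q} → 1 ≤ q →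
  slice (suc (length xs +ℕ p)) (length xs +ℕ q ∸ 1) (xs ++ ys) ≡ slice (suc p) (q ∸ 1) ys
slice-interior-++ʳ xs ys {p} {q} 1≤q =
  trans (cong₂ (λ a b → slice a b (xs ++ ys)) (sym (+-suc (length xs) p)) (+-∸-assoc (length xs) 1≤q))
        (slice-++ʳ xs ys (q ∸ 1) (s≤s z≤n))

NoncrossingList-++⁻ : ∀ X Y {S T} k → length Y ≡ length X →
                      NoncrossingList (length X +ℕ k) (X ++ S) (Y ++ T) → NoncrossingList k S T
NoncrossingList-++⁻ X Y {S} {T} k |Y|≡|X| nc p q 1≤p p<q q≤k
  with nc (ℓ +ℕ p) (ℓ +ℕ q) (≤-trans 1≤p (m≤n+m p ℓ)) (+-monoʳ-< ℓ p<q) (+-monoʳ-≤ ℓ q≤k)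
  where ℓ = length X
... | inj₁ ws    = inj₁ (subst₂ WeaklySeparated (slice-++ʳ X S q 1≤p) (Y-shift (slice-++ʳ Y T q 1≤p)) ws)
  where
  Y-shift : ∀ {A} → slice (length Y +ℕ p) (length Y +ℕ q) (Y ++ T) ≡ A →
            slice (length X +ℕ p) (length X +ℕ q) (Y ++ T) ≡ A
  Y-shift = subst (λ t → slice (t +ℕ p) (t +ℕ q) (Y ++ T) ≡ _) |Y|≡|X|
... | inj₂ ¬same = inj₂ (λ same → ¬same (subst₂ SameSet
        (sym (slice-interior-++ʳ X S 1≤q))
        (sym (subst (λ t → slice (suc (t +ℕ p)) (t +ℕ q ∸ 1) (Y ++ T) ≡ _) |Y|≡|X| (slice-interior-++ʳ Y T 1≤q)))
        same))
  where
  1≤q : 1 ≤ q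
  1≤q = ≤-trans 1≤p (<⇒≤ p<q)

∉-ends : ∀ {a b c : ℕ} {G} → a ≢ b → a ≢ c → a ∉ G → a ∉ b ∷ (G ++ c ∷ [])
∉-ends a≢b a≢c a∉G (here a≡b)  = a≢b a≡b
∉-ends {G = G} a≢b a≢c a∉G (there a∈) with ∈-++⁻ G a∈
... | inj₁ a∈G        = a∉G a∈G
... | inj₂ (here a≡c) = a≢c a≡c

interleaved-crossing : ∀ {a b c d G} → a < b → b < c → c < d → All (b <_) G → All (_< c) G →
                       Crossing (a ∷ (G ++ c ∷ [])) (b ∷ (G ++ d ∷ []))
interleaved-crossing {a} {b} {c} {d} {G} a<b b<c c<d b<G G<c =
  a , b , c , d , inj₁ (a<b , b<c , c<d)
  , (here refl , ∉-ends (<⇒≢ a<b) (<⇒≢ a<d) (λ a∈ → <-asym a<b (All.lookup b<G a∈)))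
  , (c∈ , ∉-ends (>⇒≢ b<c) (<⇒≢ c<d) (λ c∈G → <-irrefl refl (All.lookup G<c c∈G)))
  , (here refl , ∉-ends (>⇒≢ a<b) (<⇒≢ b<c) (λ b∈ → <-irrefl refl (All.lookup b<G b∈)))
  , (d∈ , ∉-ends (>⇒≢ a<d) (>⇒≢ c<d) (λ d∈G → <-asym (All.lookup G<c d∈G) c<d))
  where
  a<d = <-trans a<b (<-trans b<c c<d)
  c∈ : c ∈ a ∷ (G ++ c ∷ [])
  c∈ = there (∈-++⁺ʳ G (here refl))
  d∈ : d ∈ b ∷ (G ++ d ∷ [])
  d∈ = there (∈-++⁺ʳ G (here refl))

take-suc-length : ∀ g (z : ℕ) W → take (suc (length g)) (g ++ z ∷ W) ≡ g ++ z ∷ []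
take-suc-length []      z W = refl
take-suc-length (x ∷ g) z W = cong (x ∷_) (take-suc-length g z W)

slice-around : ∀ P g z W → 1 ≤ length P →
  slice (length P) (suc (length P +ℕ length g)) (P ++ g ++ z ∷ W) ≡ nth P (length P) ∷ (g ++ z ∷ [])
slice-around (x ∷ [])    g z W _ = cong (x ∷_) (take-suc-length g z W)
slice-around (x ∷ y ∷ P) g z W _ = slice-around (y ∷ P) g z W (s≤s z≤n)

slice-around′ : ∀ (P P′ : List ℕ) g z W → length P′ ≡ length P → 1 ≤ length P →
  slice (length P) (suc (length P +ℕ length g)) (P′ ++ g ++ z ∷ W) ≡ nth P′ (length P) ∷ (g ++ z ∷ [])
slice-around′ P P′ g z W |P′|≡|P| 1≤ =
  subst (λ t → slice t (suc (t +ℕ length g)) (P′ ++ g ++ z ∷ W) ≡ nth P′ t ∷ (g ++ z ∷ []))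
        |P′|≡|P| (slice-around P′ g z W (subst (1 ≤_) (sym |P′|≡|P|) 1≤))

-- The slices at p = |P| and q = |P| + |g| + 1 are a ∷ g ++ [z] and b ∷ g ++ [z′] with
-- a < b < z < z′ and g between b and z: equal interiors, yet a crossing.
interleaved-ends⇒¬Noncrossing :
  ∀ P P′ g {z z′ W W′ k} → length P′ ≡ length P → 1 ≤ length P →
  nth P (length P) < nth P′ (length P) → All (nth P′ (length P) <_) g → All (_< z) g →
  nth P′ (length P) < z → z < z′ → suc (length P +ℕ length g) ≤ k →
  ¬ NoncrossingList k (P ++ g ++ z ∷ W) (P′ ++ g ++ z′ ∷ W′)
interleaved-ends⇒¬Noncrossing P P′ g {z} {z′} {W} {W′} |P′|≡|P| 1≤ a<b b<g g<z b<z z<z′ q≤k nc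
  with nc (length P) (suc (length P +ℕ length g)) 1≤ (s≤s (m≤m+n _ _)) q≤k
... | inj₁ ws    = ws (subst₂ Crossing (sym (slice-around P g z W 1≤))
                                      (sym (slice-around′ P P′ g z′ W′ |P′|≡|P| 1≤))
                                      (interleaved-crossing a<b b<z z<z′ b<g g<z))
... | inj₂ ¬same = ¬same (subst₂ SameSet (sym (slice-++-middle P g (z ∷ W)))
                                        (sym interior′) (λ _ → (λ x∈ → x∈) , (λ x∈ → x∈)))
  where
  interior′ : slice (suc (length P)) (suc (length P +ℕ length g) ∸ 1) (P′ ++ g ++ z′ ∷ W′) ≡ g
  interior′ = subst (λ t → slice (suc t) (suc (t +ℕ length g) ∸ 1) (P′ ++ g ++ z′ ∷ W′) ≡ g)
                    |P′|≡|P| (slice-++-middle P′ g (z′ ∷ W′))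

concatMap-singles : ∀ {f : Segment → List ℕ} → (∀ x → f (single x) ≡ x ∷ []) →
                    ∀ g os → concatMap f (map single g ++ os) ≡ g ++ concatMap f os
concatMap-singles f-single []      os = refl
concatMap-singles f-single (x ∷ g) os = cong₂ _++_ (f-single x) (concatMap-singles f-single g os)

orientations-singles : ∀ g os → orientations (map single g ++ os) ≡ orientations os
orientations-singles []      os = refl
orientations-singles (x ∷ g) os = orientations-singles g os

flip-singles : ∀ g os → map flip (map single g ++ os) ≡ map single g ++ map flip os
flip-singles []      os = refl
flip-singles (x ∷ g) os = cong (single x ∷_) (flip-singles g os)

snoc-++-uncons : ∀ ys (y : ℕ) R → ∃[ z ] ∃[ W ] ((ys ++ y ∷ []) ++ R ≡ z ∷ W × z ∈ ys ++ y ∷ [])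
snoc-++-uncons []       y R = y , R , refl , here refl
snoc-++-uncons (x ∷ ys) y R = x , (ys ++ y ∷ []) ++ R , refl , here refl

length-around : ∀ (P g : List ℕ) z W → suc (length P +ℕ length g) ≤ length (P ++ g ++ z ∷ W)
length-around []      []      z W = s≤s z≤n
length-around []      (x ∷ g) z W = s≤s (length-around [] g z W)
length-around (x ∷ P) g       z W = s≤s (length-around P g z W)

-- Two true blocks separated only by fixed elements g: at the last place of the first block
-- and the first place of the second one the slices are (i_last ∷ g ++ [i′]) and (j ∷ g ++ [z′]).
consecutive-true-blocks⇒¬Noncrossing :
  ∀ i xs j g i′ ys j′ rest →
  let os = block true i xs j ∷ (map single g ++ block true i′ ys j′ ∷ rest) in
  Sorted (flatAll os) → ¬ NoncrossingList (length (flatS os)) (flatS os) (flatT os)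
consecutive-true-blocks⇒¬Noncrossing i xs j g i′ ys j′ rest s nc
  with z′ , W′ , T-tail≡ , z′∈ ← snoc-++-uncons ys j′ (flatT rest) =
  interleaved-ends⇒¬Noncrossing (i ∷ xs) (xs ++ j ∷ []) g
    (length-snoc xs j) (s≤s z≤n)
    (subst (nth (i ∷ xs) (suc r) <_) (sym j≡)
       (Sorted-++⇒< (i ∷ xs) s′ (nth-∈ (i ∷ xs) (s≤s z≤n) ≤-refl) (here refl)))
    (subst (λ b → All (b <_) g) (sym j≡) (All.++⁻ˡ g j<after))
    (All.tabulate (λ x∈g → Sorted-++⇒< g s-after x∈g (here refl)))
    (subst (_< i′) (sym j≡) (All.lookup j<after (∈-++⁺ʳ g (here refl))))
    (All.lookup i′<tail (∈-++⁺ˡ z′∈))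
    (subst (suc (length (i ∷ xs) +ℕ length g) ≤_) (cong length (sym S≡))
       (length-around (i ∷ xs) g i′ (ys ++ flatS rest)))
    (subst₂ (NoncrossingList _) S≡ T≡ nc)
  where
  r = length xs
  after = g ++ i′ ∷ (ys ++ j′ ∷ []) ++ flatAll rest
  s′ : Sorted ((i ∷ xs) ++ j ∷ after)
  s′ = subst (λ zs → Sorted (i ∷ zs))
         (trans (cong ((xs ++ j ∷ []) ++_) (concatMap-singles (λ _ → refl) g _)) (++-assoc xs (j ∷ []) after)) s
  j≡ : nth (xs ++ j ∷ []) (suc r) ≡ j
  j≡ = nth-after xs j []
  j<after : All (j <_) after
  j<after = AllPairs.head (Sorted-++⁻ʳ (i ∷ xs) s′)
  s-after : Sorted after
  s-after = AllPairs.tail (Sorted-++⁻ʳ (i ∷ xs) s′)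
  i′<tail : All (i′ <_) ((ys ++ j′ ∷ []) ++ flatAll rest)
  i′<tail = AllPairs.head (Sorted-++⁻ʳ g s-after)
  S≡ : flatS (block true i xs j ∷ (map single g ++ block true i′ ys j′ ∷ rest)) ≡ (i ∷ xs) ++ g ++ i′ ∷ ys ++ flatS rest
  S≡ = cong ((i ∷ xs) ++_) (concatMap-singles (λ _ → refl) g _)
  T≡ : flatT (block true i xs j ∷ (map single g ++ block true i′ ys j′ ∷ rest)) ≡ (xs ++ j ∷ []) ++ g ++ z′ ∷ W′
  T≡ = cong ((xs ++ j ∷ []) ++_) (trans (concatMap-singles (λ _ → refl) g _) (cong (g ++_) T-tail≡))

NoncrossingSegments : List Segment → Set
NoncrossingSegments os = NoncrossingList (length (flatS os)) (flatS os) (flatT os)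

NoncrossingSegments-flip : ∀ os → NoncrossingSegments os → NoncrossingSegments (map flip os)
NoncrossingSegments-flip os nc =
  subst₂ (λ A B → NoncrossingList (length A) A B) (sym (concatMap-flip segS-flip os)) (sym (concatMap-flip segT-flip os))
    (subst (λ k → NoncrossingList k (flatT os) (flatS os)) (length-flatS os) (NoncrossingList-sym nc))

Sorted-flip : ∀ os → Sorted (flatAll os) → Sorted (flatAll (map flip os))
Sorted-flip os = subst Sorted (sym (concatMap-flip segAll-flip os))

first-block : ∀ os → orientations os ≡ []
  ⊎ ∃[ g ] ∃[ d ] ∃[ i ] ∃[ xs ] ∃[ j ] ∃[ rest ] os ≡ map single g ++ block d i xs j ∷ rest
first-block []                    = inj₁ refl
first-block (block d i xs j ∷ os) = inj₂ ([] , d , i , xs , j , os , refl)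
first-block (single x ∷ os) with first-block os
... | inj₁ none = inj₁ none
... | inj₂ (g , d , i , xs , j , rest , refl) = inj₂ (x ∷ g , d , i , xs , j , rest , refl)

next-block-flipped : ∀ c i xs j os → Sorted (flatAll (block c i xs j ∷ os)) →
                     NoncrossingSegments (block c i xs j ∷ os) →
                     Alternating (orientations os) → Alternating (c ∷ orientations os)
next-block-flipped c i xs j os s nc a with first-block os
... | inj₁ none rewrite none = [-]
... | inj₂ (g , d , i′ , ys , j′ , rest , refl) rewrite orientations-singles g (block d i′ ys j′ ∷ rest) =
  opposite c d s nc ∷ a
  where
  segments : Bool → Bool → List Segment → List Segment
  segments c d rest = block c i xs j ∷ (map single g ++ block d i′ ys j′ ∷ rest)
  flip-segments : map flip (segments false false rest) ≡ segments true true (map flip rest)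
  flip-segments = cong (block true i xs j ∷_) (flip-singles g _)
  opposite : ∀ c d → Sorted (flatAll (segments c d rest)) → NoncrossingSegments (segments c d rest) → d ≡ not c
  opposite true  false _ _  = refl
  opposite false true  _ _  = refl
  opposite true  true  s nc = ⊥-elim (consecutive-true-blocks⇒¬Noncrossing i xs j g i′ ys j′ rest s nc)
  opposite false false s nc = ⊥-elim (consecutive-true-blocks⇒¬Noncrossing i xs j g i′ ys j′ (map flip rest)
    (subst (λ os → Sorted (flatAll os)) flip-segments (Sorted-flip (segments false false rest) s))
    (subst NoncrossingSegments flip-segments (NoncrossingSegments-flip (segments false false rest) nc)))

NoncrossingSegments-++⁻ : ∀ o os → NoncrossingSegments (o ∷ os) → NoncrossingSegments os
NoncrossingSegments-++⁻ o os nc =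
  NoncrossingList-++⁻ (segS o) (segT o) _ (sym (length-segS o))
    (subst (λ k → NoncrossingList k (segS o ++ flatS os) (segT o ++ flatT os)) (length-++ (segS o)) nc)

noncrossing⇒alternating : ∀ os → Sorted (flatAll os) → NoncrossingSegments os → Alternating (orientations os)
noncrossing⇒alternating []                    s nc = []
noncrossing⇒alternating (single x ∷ os)       s nc =
  noncrossing⇒alternating os (AllPairs.tail s) (NoncrossingSegments-++⁻ (single x) os nc)
noncrossing⇒alternating (block c i xs j ∷ os) s nc =
  next-block-flipped c i xs j os s nc
    (noncrossing⇒alternating os (Sorted-++⁻ʳ (segAll (block c i xs j)) s)
                              (NoncrossingSegments-++⁻ (block c i xs j) os nc))

noncrossing⇔alternating : ∀ os → Sorted (flatAll os) → NoncrossingSegments os ⇔ Alternating (orientations os)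
noncrossing⇔alternating os s = mk⇔ (noncrossing⇒alternating os s) (alternating⇒noncrossing os s)

-- Telescoping sums

data PairSwap : List ℕ → List ℕ → List ℕ → List ℕ → Set where
  []   : PairSwap [] [] [] []
  keep : ∀ {x y S T S′ T′} → PairSwap S T S′ T′ → PairSwap (x ∷ S) (y ∷ T) (x ∷ S′) (y ∷ T′)
  swap : ∀ {x y S T S′ T′} → PairSwap S T S′ T′ → PairSwap (x ∷ S) (y ∷ T) (y ∷ S′) (x ∷ T′)

PairSwap-++ : ∀ {S T S′ T′ U V U′ V′} → PairSwap S T S′ T′ → PairSwap U V U′ V′ →
              PairSwap (S ++ U) (T ++ V) (S′ ++ U′) (T′ ++ V′)
PairSwap-++ []      σ = σ
PairSwap-++ (keep τ) σ = keep (PairSwap-++ τ σ)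
PairSwap-++ (swap τ) σ = swap (PairSwap-++ τ σ)

PairSwap-refl : ∀ S T → length S ≡ length T → PairSwap S T S T
PairSwap-refl []      []      _ = []
PairSwap-refl (x ∷ S) (y ∷ T) e = keep (PairSwap-refl S T (suc-injective e))

PairSwap-swap : ∀ S T → length S ≡ length T → PairSwap S T T S
PairSwap-swap []      []      _ = []
PairSwap-swap (x ∷ S) (y ∷ T) e = swap (PairSwap-swap S T (suc-injective e))

PairSwap-block : ∀ c c′ i xs j →
  PairSwap (segS (block c i xs j)) (segT (block c i xs j)) (segS (block c′ i xs j)) (segT (block c′ i xs j))
PairSwap-block true  true  i xs j = PairSwap-refl _ _ (length-segS (block true i xs j))
PairSwap-block false false i xs j = PairSwap-refl _ _ (length-segS (block false i xs j))
PairSwap-block true  false i xs j = PairSwap-swap _ _ (length-segS (block true i xs j))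
PairSwap-block false true  i xs j = PairSwap-swap _ _ (length-segS (block false i xs j))

PairSwap-cong : ∀ {S T S′ T′ S₀ T₀ S₀′ T₀′} → S ≡ S₀ → T ≡ T₀ → S′ ≡ S₀′ → T′ ≡ T₀′ →
                PairSwap S₀ T₀ S₀′ T₀′ → PairSwap S T S′ T′
PairSwap-cong refl refl refl refl τ = τ

PairSwap-nth : ∀ {S T S′ T′} (φ : ℕ → ℤ) t → PairSwap S T S′ T′ →
               φ (nth S t) + φ (nth T t) ≡ φ (nth S′ t) + φ (nth T′ t)
PairSwap-nth φ zero          _                  = refl
PairSwap-nth φ (suc t)       []                 = refl
PairSwap-nth φ (suc zero)    (keep _)           = refl
PairSwap-nth φ (suc zero)    (swap {x} {y} _)   = ℤₚ.+-comm (φ x) (φ y)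
PairSwap-nth φ (suc (suc t)) (keep τ)           = PairSwap-nth φ (suc t) τ
PairSwap-nth φ (suc (suc t)) (swap τ)           = PairSwap-nth φ (suc t) τ

sumFrom : (ℕ → ℤ) → ℕ → ℕ → ℤ
sumFrom g a zero    = + 0
sumFrom g a (suc n) = g a + sumFrom g (suc a) n

sum-applyUpTo : ∀ g a n → sumℤ (applyUpTo (λ d → g (a +ℕ d)) n) ≡ sumFrom g a n
sum-applyUpTo g a zero    = refl
sum-applyUpTo g a (suc n) =
  cong₂ _+_ (cong g (+-identityʳ a))
            (trans (cong sumℤ (applyUpTo-cong (λ d → cong g (+-suc a d)) n)) (sum-applyUpTo g (suc a) n))
  where
  applyUpTo-cong : ∀ {f h : ℕ → ℤ} → (∀ d → f d ≡ h d) → ∀ n → applyUpTo f n ≡ applyUpTo h n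
  applyUpTo-cong f≗h zero    = refl
  applyUpTo-cong f≗h (suc n) = cong₂ _∷_ (f≗h 0) (applyUpTo-cong (λ d → f≗h (suc d)) n)

rangeSum≡sumFrom : ∀ a b g → rangeSum a b g ≡ sumFrom g a (suc b ∸ a)
rangeSum≡sumFrom a b g =
  trans (cong sumℤ (map-applyUpTo (λ d → d) (λ d → g (a +ℕ d)) (suc b ∸ a))) (sum-applyUpTo g a (suc b ∸ a))

sumFrom-+ : ∀ g a m n → sumFrom g a (m +ℕ n) ≡ sumFrom g a m + sumFrom g (a +ℕ m) n
sumFrom-+ g a zero    n = trans (cong (λ b → sumFrom g b n) (sym (+-identityʳ a))) (sym (ℤₚ.+-identityˡ _))
sumFrom-+ g a (suc m) n = begin
  g a + sumFrom g (suc a) (m +ℕ n)                              ≡⟨ cong (λ s → g a + s) (sumFrom-+ g (suc a) m n) ⟩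
  g a + (sumFrom g (suc a) m + sumFrom g (suc a +ℕ m) n)        ≡⟨ ℤₚ.+-assoc (g a) _ _ ⟨
  (g a + sumFrom g (suc a) m) + sumFrom g (suc a +ℕ m) n
    ≡⟨ cong (λ b → g a + sumFrom g (suc a) m + sumFrom g b n) (+-suc a m) ⟨
  (g a + sumFrom g (suc a) m) + sumFrom g (a +ℕ suc m) n        ∎
  where open ≡-Reasoning

sumFrom-+-distrib : ∀ g h a n → sumFrom g a n + sumFrom h a n ≡ sumFrom (λ t → g t + h t) a n
sumFrom-+-distrib g h a zero    = refl
sumFrom-+-distrib g h a (suc n) =
  trans (interchange (g a) _ (h a) _) (cong (λ s → g a + h a + s) (sumFrom-+-distrib g h (suc a) n))

sumFrom-cong : ∀ {g h} a n → (∀ t → a ≤ t → t < a +ℕ n → g t ≡ h t) → sumFrom g a n ≡ sumFrom h a n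
sumFrom-cong a zero    _   = refl
sumFrom-cong a (suc n) g≡h =
  cong₂ _+_ (g≡h a ≤-refl (m<m+n a (s≤s z≤n)))
            (sumFrom-cong (suc a) n (λ t a<t t< → g≡h t (<⇒≤ a<t) (subst (t <_) (sym (+-suc a n)) t<)))

-- Σ_{t=a}^{b} g t = Σ_{t=1}^{b} g t − Σ_{t=1}^{a-1} g t, with the subtraction moved to the left.
rangeSum-telescope : ∀ g a b → 1 ≤ a → a ≤ suc b → rangeSum a b g + sumFrom g 1 (a ∸ 1) ≡ sumFrom g 1 b
rangeSum-telescope g (suc a) b _ a≤b = begin
  rangeSum (suc a) b g + sumFrom g 1 a          ≡⟨ cong (_+ sumFrom g 1 a) (rangeSum≡sumFrom (suc a) b g) ⟩
  sumFrom g (suc a) (b ∸ a) + sumFrom g 1 a     ≡⟨ ℤₚ.+-comm _ (sumFrom g 1 a) ⟩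
  sumFrom g 1 a + sumFrom g (1 +ℕ a) (b ∸ a)    ≡⟨ sumFrom-+ g 1 a (b ∸ a) ⟨
  sumFrom g 1 (a +ℕ (b ∸ a))                    ≡⟨ cong (sumFrom g 1) (m+[n∸m]≡n (≤-pred a≤b)) ⟩
  sumFrom g 1 b                                 ∎
  where open ≡-Reasoning

<suc-pred⇒< : ∀ {ℓ} k → 1 ≤ ℓ → ℓ < suc (k ∸ 1) → ℓ < k
<suc-pred⇒< zero    1≤ℓ (s≤s ℓ≤0) = ⊥-elim (<⇒≱ 1≤ℓ ℓ≤0)
<suc-pred⇒< (suc k) _   ℓ<        = ℓ<

Γ-term : (ℕ → ℕ → ℤ) → List ℕ → ℕ → ℤ
Γ-term w xs ℓ = rangeSum (nth xs ℓ ∸ (ℓ ∸ 1)) (nth xs (suc ℓ) ∸ ℓ ∸ 1) (w ℓ)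

Γ : (ℕ → ℕ → ℤ) → ℕ → List ℕ → ℤ
Γ w k xs = rangeSum 1 (k ∸ 1) (Γ-term w xs)

record IsSubsetList (k : ℕ) (xs : List ℕ) : Set where
  field
    sorted   : Sorted xs
    positive : All (0 <_) xs
    length≡  : length xs ≡ k

Γ-term-telescope : ∀ w {k xs} → IsSubsetList k xs → ∀ ℓ → 1 ≤ ℓ → ℓ < k →
  Γ-term w xs ℓ + sumFrom (w ℓ) 1 (nth xs ℓ ∸ (ℓ ∸ 1) ∸ 1) ≡ sumFrom (w ℓ) 1 (nth xs (suc ℓ) ∸ ℓ ∸ 1)
Γ-term-telescope w {xs = xs} ok (suc l) _ ℓ<k =
  rangeSum-telescope (w (suc l)) (x ∸ l) (y ∸ suc l ∸ 1) 1≤x∸l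
    (subst (x ∸ l ≤_) (sym (m+[n∸m]≡n (≤-trans 1≤x∸l x∸l≤))) x∸l≤)
  where
  open IsSubsetList ok
  x = nth xs (suc l)
  y = nth xs (suc (suc l))
  1≤x∸l : 1 ≤ x ∸ l
  1≤x∸l = subst (_≤ x ∸ l) (m+n∸n≡m 1 l)
            (∸-monoˡ-≤ l (nth-≥ sorted positive (s≤s z≤n) (≤-trans (<⇒≤ ℓ<k) (≤-reflexive (sym length≡)))))
  x∸l≤ : x ∸ l ≤ y ∸ suc l
  x∸l≤ = ∸-monoˡ-≤ (suc l) (Sorted-nth-< sorted (s≤s z≤n) ≤-refl (≤-trans ℓ<k (≤-reflexive (sym length≡))))

Γ-term-PairSwap : ∀ w {k S T S′ T′} → PairSwap S T S′ T′ →
  IsSubsetList k S → IsSubsetList k T → IsSubsetList k S′ → IsSubsetList k T′ →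
  ∀ ℓ → 1 ≤ ℓ → ℓ < k → Γ-term w S ℓ + Γ-term w T ℓ ≡ Γ-term w S′ ℓ + Γ-term w T′ ℓ
Γ-term-PairSwap w {S = S} {T} {S′} {T′} τ okS okT okS′ okT′ ℓ 1≤ℓ ℓ<k =
  ∙-cancelʳ (before S + before T) _ _ (begin
    (term S + term T) + (before S + before T)  ≡⟨ interchange (term S) (term T) _ _ ⟩
    (term S + before S) + (term T + before T)  ≡⟨ cong₂ _+_ (telescope okS) (telescope okT) ⟩
    after S + after T                          ≡⟨ PairSwap-nth (λ y → sumFrom (w ℓ) 1 (y ∸ ℓ ∸ 1)) (suc ℓ) τ ⟩
    after S′ + after T′                        ≡⟨ cong₂ _+_ (telescope okS′) (telescope okT′) ⟨
    (term S′ + before S′) + (term T′ + before T′) ≡⟨ interchange (term S′) _ (term T′) _ ⟩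
    (term S′ + term T′) + (before S′ + before T′)
      ≡⟨ cong (λ z → term S′ + term T′ + z) (PairSwap-nth (λ x → sumFrom (w ℓ) 1 (x ∸ (ℓ ∸ 1) ∸ 1)) ℓ τ) ⟨
    (term S′ + term T′) + (before S + before T) ∎)
  where
  open ≡-Reasoning
  term before after : List ℕ → ℤ
  term xs   = Γ-term w xs ℓ
  before xs = sumFrom (w ℓ) 1 (nth xs ℓ ∸ (ℓ ∸ 1) ∸ 1)
  after xs  = sumFrom (w ℓ) 1 (nth xs (suc ℓ) ∸ ℓ ∸ 1)
  telescope : ∀ {xs} → IsSubsetList _ xs → term xs + before xs ≡ after xs
  telescope ok = Γ-term-telescope w ok ℓ 1≤ℓ ℓ<k

Γ-PairSwap : ∀ w k {S T S′ T′} → PairSwap S T S′ T′ →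
             IsSubsetList k S → IsSubsetList k T → IsSubsetList k S′ → IsSubsetList k T′ →
             Γ w k S + Γ w k T ≡ Γ w k S′ + Γ w k T′
Γ-PairSwap w k {S} {T} {S′} {T′} τ okS okT okS′ okT′ = begin
  Γ w k S + Γ w k T
    ≡⟨ cong₂ _+_ (rangeSum≡sumFrom 1 (k ∸ 1) (Γ-term w S)) (rangeSum≡sumFrom 1 (k ∸ 1) (Γ-term w T)) ⟩
  sumFrom (Γ-term w S) 1 (k ∸ 1) + sumFrom (Γ-term w T) 1 (k ∸ 1)
    ≡⟨ sumFrom-+-distrib (Γ-term w S) (Γ-term w T) 1 (k ∸ 1) ⟩
  sumFrom (λ ℓ → Γ-term w S ℓ + Γ-term w T ℓ) 1 (k ∸ 1)
    ≡⟨ sumFrom-cong 1 (k ∸ 1) (λ ℓ 1≤ℓ ℓ< →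
         Γ-term-PairSwap w τ okS okT okS′ okT′ ℓ 1≤ℓ (<suc-pred⇒< k 1≤ℓ ℓ<)) ⟩
  sumFrom (λ ℓ → Γ-term w S′ ℓ + Γ-term w T′ ℓ) 1 (k ∸ 1)
    ≡⟨ sumFrom-+-distrib (Γ-term w S′) (Γ-term w T′) 1 (k ∸ 1) ⟨
  sumFrom (Γ-term w S′) 1 (k ∸ 1) + sumFrom (Γ-term w T′) 1 (k ∸ 1)
    ≡⟨ cong₂ _+_ (rangeSum≡sumFrom 1 (k ∸ 1) (Γ-term w S′)) (rangeSum≡sumFrom 1 (k ∸ 1) (Γ-term w T′)) ⟨
  Γ w k S′ + Γ w k T′ ∎
  where open ≡-Reasoning

-- The segment lists of the cube

fixed : Segment → List ℕ
fixed (single x)       = x ∷ []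
fixed (block _ _ xs _) = xs

Fixed : List Segment → List ℕ
Fixed = concatMap fixed

segS-∈⁻ : ∀ o {x} → x ∈ segS o → x ∈ fixed o ⊎ x ∈ ownS o
segS-∈⁻ (single y)           x∈          = inj₁ x∈
segS-∈⁻ (block true  i xs j) (here x≡i)  = inj₂ (here x≡i)
segS-∈⁻ (block true  i xs j) (there x∈)  = inj₁ x∈
segS-∈⁻ (block false i xs j) x∈ with ∈-++⁻ xs x∈
... | inj₁ x∈xs = inj₁ x∈xs
... | inj₂ x∈j  = inj₂ x∈j

segS-∈⁺ : ∀ o {x} → x ∈ fixed o ⊎ x ∈ ownS o → x ∈ segS o
segS-∈⁺ (single y)           (inj₁ x∈)  = x∈
segS-∈⁺ (block true  i xs j) (inj₁ x∈)  = there x∈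
segS-∈⁺ (block true  i xs j) (inj₂ x∈)  = ∈-++⁺ˡ {ys = xs} x∈
segS-∈⁺ (block false i xs j) (inj₁ x∈)  = ∈-++⁺ˡ x∈
segS-∈⁺ (block false i xs j) (inj₂ x∈)  = ∈-++⁺ʳ xs x∈

flatS-∈⁻ : ∀ os {x} → x ∈ flatS os → x ∈ Fixed os ⊎ x ∈ OwnS os
flatS-∈⁻ (o ∷ os) x∈ with ∈-++⁻ (segS o) x∈
... | inj₂ x∈os = Sum.map (∈-++⁺ʳ (fixed o)) (∈-++⁺ʳ (ownS o)) (flatS-∈⁻ os x∈os)
... | inj₁ x∈o with segS-∈⁻ o x∈o
...   | inj₁ x∈f = inj₁ (∈-++⁺ˡ x∈f)
...   | inj₂ x∈w = inj₂ (∈-++⁺ˡ x∈w)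

flatS-∈⁺ : ∀ os {x} → x ∈ Fixed os ⊎ x ∈ OwnS os → x ∈ flatS os
flatS-∈⁺ (o ∷ os) (inj₁ x∈) with ∈-++⁻ (fixed o) x∈
... | inj₁ x∈o  = ∈-++⁺ˡ (segS-∈⁺ o (inj₁ x∈o))
... | inj₂ x∈os = ∈-++⁺ʳ (segS o) (flatS-∈⁺ os (inj₁ x∈os))
flatS-∈⁺ (o ∷ os) (inj₂ x∈) with ∈-++⁻ (ownS o) x∈
... | inj₁ x∈o  = ∈-++⁺ˡ (segS-∈⁺ o (inj₂ x∈o))
... | inj₂ x∈os = ∈-++⁺ʳ (segS o) (flatS-∈⁺ os (inj₂ x∈os))

length-flatS≡ : ∀ os → length (flatS os) ≡ length (Fixed os) +ℕ length (orientations os)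
length-flatS≡ []                    = refl
length-flatS≡ (single x ∷ os)       = cong suc (length-flatS≡ os)
length-flatS≡ (block c i xs j ∷ os) = begin
  length (segS (block c i xs j) ++ flatS os)                        ≡⟨ length-++ (segS (block c i xs j)) ⟩
  length (segS (block c i xs j)) +ℕ length (flatS os)               ≡⟨ cong₂ _+ℕ_ (length-seg c) (length-flatS≡ os) ⟩
  suc (length xs) +ℕ (length (Fixed os) +ℕ length (orientations os)) ≡⟨ cong suc (+-assoc (length xs) _ _) ⟨
  suc (length xs +ℕ length (Fixed os) +ℕ length (orientations os))   ≡⟨ +-suc _ (length (orientations os)) ⟨
  length xs +ℕ length (Fixed os) +ℕ suc (length (orientations os))   ≡⟨ cong (_+ℕ suc _) (length-++ xs) ⟨
  length (xs ++ Fixed os) +ℕ suc (length (orientations os))         ∎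
  where
  open ≡-Reasoning
  length-seg : ∀ c → length (segS (block c i xs j)) ≡ suc (length xs)
  length-seg true  = refl
  length-seg false = length-snoc xs j

-- Opaque, so that unification never has to look inside the filters.
opaque
  below above : ℕ → List ℕ → List ℕ
  below x = filter (_<? x)
  above y = filter (y <?_)

  between : ℕ → ℕ → List ℕ → List ℕ
  between x y = filter (λ z → x <? z ×-dec z <? y)

  below-∈⁻ : ∀ {x y Ls} → x ∈ below y Ls → x ∈ Ls × x < y
  below-∈⁻ {y = y} = ∈-filter⁻ (_<? y)

  above-∈⁻ : ∀ {x y Ls} → x ∈ above y Ls → x ∈ Ls × y < x
  above-∈⁻ {y = y} = ∈-filter⁻ (y <?_)

  between-∈⁻ : ∀ {x y z Ls} → x ∈ between y z Ls → x ∈ Ls × (y < x × x < z)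
  between-∈⁻ {y = y} {z} = ∈-filter⁻ (λ w → y <? w ×-dec w <? z)

  below-∈⁺ : ∀ {x y Ls} → x ∈ Ls → x < y → x ∈ below y Ls
  below-∈⁺ {y = y} = ∈-filter⁺ (_<? y)

  above-∈⁺ : ∀ {x y Ls} → x ∈ Ls → y < x → x ∈ above y Ls
  above-∈⁺ {y = y} = ∈-filter⁺ (y <?_)

  between-∈⁺ : ∀ {x y z Ls} → x ∈ Ls → y < x × x < z → x ∈ between y z Ls
  between-∈⁺ {y = y} {z} = ∈-filter⁺ (λ w → y <? w ×-dec w <? z)

  below-⊆ : ∀ y Ls → below y Ls ⊆ Ls
  below-⊆ y = filter-⊆ (_<? y)

  above-⊆ : ∀ y Ls → above y Ls ⊆ Ls
  above-⊆ y = filter-⊆ (y <?_)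

  between-⊆ : ∀ y z Ls → between y z Ls ⊆ Ls
  between-⊆ y z = filter-⊆ (λ w → y <? w ×-dec w <? z)

-- The segments of the vertex pair chosen by c: the fixed elements Ls, cut by the cube pairs
-- (I a, J a) into singles and blocks.
firstBlock : ∀ {m} → (I J : Fin (suc m) → ℕ) → Bool → List ℕ → Segment
firstBlock I J b Ls = block b (I Fin.zero) (between (I Fin.zero) (J Fin.zero) Ls) (J Fin.zero)

build : ∀ {m} → (I J : Fin m → ℕ) → (Fin m → Bool) → List ℕ → List Segment
build {zero}  I J c Ls = map single Ls
build {suc m} I J c Ls =
  map single (below (I Fin.zero) Ls) ++ firstBlock I J (c Fin.zero) Ls
  ∷ build (I ∘ Fin.suc) (J ∘ Fin.suc) (c ∘ Fin.suc) (above (J Fin.zero) Ls)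

orientations-build : ∀ {m} (I J : Fin m → ℕ) c Ls → orientations (build I J c Ls) ≡ tabulate c
orientations-build {zero}  I J c Ls = trans (cong orientations (sym (++-identityʳ (map single Ls)))) (orientations-singles Ls [])
orientations-build {suc m} I J c Ls =
  trans (orientations-singles (below _ Ls) _)
        (cong (c Fin.zero ∷_) (orientations-build _ _ (c ∘ Fin.suc) _))

flip-build : ∀ {m} (I J : Fin m → ℕ) c Ls → map flip (build I J c Ls) ≡ build I J (not ∘ c) Ls
flip-build {zero}  I J c Ls = trans (cong (map flip) (sym (++-identityʳ _))) (trans (flip-singles Ls []) (++-identityʳ _))
flip-build {suc m} I J c Ls =
  trans (flip-singles (below _ Ls) _)
        (cong (λ os → map single (below (I Fin.zero) Ls) ++ firstBlock I J (not (c Fin.zero)) Ls ∷ os)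
              (flip-build _ _ (c ∘ Fin.suc) _))

OwnS-singles : ∀ g os → OwnS (map single g ++ os) ≡ OwnS os
OwnS-singles []      os = refl
OwnS-singles (x ∷ g) os = OwnS-singles g os

OwnS-build : ∀ {m} (I J : Fin m → ℕ) c Ls → OwnS (build I J c Ls) ≡ tabulate (λ a → if c a then I a else J a)
OwnS-build {zero}  I J c Ls = trans (cong OwnS (sym (++-identityʳ (map single Ls)))) (OwnS-singles Ls [])
OwnS-build {suc m} I J c Ls = trans (OwnS-singles (below _ Ls) _) (cong₂ _++_ (own (c Fin.zero)) (OwnS-build _ _ (c ∘ Fin.suc) _))
  where
  own : ∀ b → ownS (firstBlock I J b Ls) ≡ (if b then I Fin.zero else J Fin.zero) ∷ []
  own true  = refl
  own false = refl

Endpoint : ∀ {m} → (I J : Fin m → ℕ) → ℕ → Set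
Endpoint I J x = ∃[ a ] (x ≡ I a ⊎ x ≡ J a)

flatAll-build : ∀ {m} (I J : Fin (suc m) → ℕ) c Ls →
  flatAll (build I J c Ls) ≡
  below (I Fin.zero) Ls ++ segAll (firstBlock I J (c Fin.zero) Ls)
  ++ flatAll (build (I ∘ Fin.suc) (J ∘ Fin.suc) (c ∘ Fin.suc) (above (J Fin.zero) Ls))
flatAll-build I J c Ls = concatMap-singles (λ _ → refl) (below (I Fin.zero) Ls) _

flatAll-build-∈⁻ : ∀ {m} (I J : Fin m → ℕ) c Ls {x} → x ∈ flatAll (build I J c Ls) → x ∈ Ls ⊎ Endpoint I J x
flatAll-build-∈⁻ {zero}  I J c Ls {x} x∈ =
  inj₁ (subst (x ∈_) (trans (cong flatAll (sym (++-identityʳ (map single Ls))))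
                            (trans (concatMap-singles (λ _ → refl) Ls []) (++-identityʳ Ls))) x∈)
flatAll-build-∈⁻ {suc m} I J c Ls {x} x∈ with ∈-++⁻ (below _ Ls) (subst (x ∈_) (flatAll-build I J c Ls) x∈)
... | inj₁ x∈A               = inj₁ (proj₁ (below-∈⁻ x∈A))
... | inj₂ (here x≡I)        = inj₂ (Fin.zero , inj₁ x≡I)
... | inj₂ (there x∈) with ∈-++⁻ (between _ _ Ls ++ _ ∷ []) x∈
...   | inj₂ x∈R with flatAll-build-∈⁻ (I ∘ Fin.suc) (J ∘ Fin.suc) (c ∘ Fin.suc) _ x∈R
...     | inj₁ x∈C           = inj₁ (proj₁ (above-∈⁻ x∈C))
...     | inj₂ (a , x≡)      = inj₂ (Fin.suc a , x≡)
flatAll-build-∈⁻ {suc m} I J c Ls x∈ | inj₂ (there _) | inj₁ x∈BJ with ∈-++⁻ (between _ _ Ls) x∈BJ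
... | inj₁ x∈B               = inj₁ (proj₁ (between-∈⁻ x∈B))
... | inj₂ (here x≡J)        = inj₂ (Fin.zero , inj₂ x≡J)

concatMap-single : ∀ {f : Segment → List ℕ} → (∀ x → f (single x) ≡ x ∷ []) → ∀ g → concatMap f (map single g) ≡ g
concatMap-single f-single g =
  trans (cong (concatMap _) (sym (++-identityʳ (map single g)))) (trans (concatMap-singles f-single g []) (++-identityʳ g))

Sorted-++-∷⁺ : ∀ {A x Y} → Sorted A → All (_< x) A → Sorted (x ∷ Y) → Sorted (A ++ x ∷ Y)
Sorted-++-∷⁺ {A} {x} {Y} sA A<x sxY@(x<Y ∷ _) = Sorted-++⁺ sA sxY A<xY
  where
  A<xY : ∀ {a y} → a ∈ A → y ∈ x ∷ Y → a < y
  A<xY a∈ (here refl) = All.lookup A<x a∈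
  A<xY a∈ (there y∈)  = <-trans (All.lookup A<x a∈) (All.lookup x<Y y∈)

record CubeData {m} (I J : Fin m → ℕ) (Ls : List ℕ) : Set where
  field
    I<J         : ∀ a → I a < J a
    J<I         : ∀ a b → toℕ a < toℕ b → J a < I b
    Ls-sorted   : Sorted Ls
    Ls∌endpoint : ∀ {x} → x ∈ Ls → ¬ Endpoint I J x

module _ {m} {I J : Fin (suc m) → ℕ} {Ls} (cube : CubeData I J Ls) where
  open CubeData cube

  CubeData-tail : CubeData (I ∘ Fin.suc) (J ∘ Fin.suc) (above (J Fin.zero) Ls)
  CubeData-tail = record
    { I<J         = I<J ∘ Fin.suc
    ; J<I         = λ a b a<b → J<I (Fin.suc a) (Fin.suc b) (s≤s a<b)
    ; Ls-sorted   = Sorted-resp-⊆ (above-⊆ _ Ls) Ls-sorted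
    ; Ls∌endpoint = λ x∈ (a , x≡) → Ls∌endpoint (proj₁ (above-∈⁻ x∈)) (Fin.suc a , x≡)
    }

  J₀<tail-endpoint : ∀ {x} → Endpoint (I ∘ Fin.suc) (J ∘ Fin.suc) x → J Fin.zero < x
  J₀<tail-endpoint (a , inj₁ refl) = J<I Fin.zero (Fin.suc a) (s≤s z≤n)
  J₀<tail-endpoint (a , inj₂ refl) = <-trans (J<I Fin.zero (Fin.suc a) (s≤s z≤n)) (I<J (Fin.suc a))

Sorted-flatAll-build : ∀ {m} {I J : Fin m → ℕ} {Ls} → CubeData I J Ls → ∀ c → Sorted (flatAll (build I J c Ls))
Sorted-flatAll-build {zero}  {Ls = Ls} cube c =
  subst Sorted (sym (concatMap-single (λ _ → refl) Ls)) (CubeData.Ls-sorted cube)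
Sorted-flatAll-build {suc m} {I} {J} {Ls} cube c =
  subst Sorted (sym (flatAll-build I J c Ls))
    (Sorted-++-∷⁺ (Sorted-resp-⊆ (below-⊆ _ Ls) Ls-sorted) (All.tabulate (λ x∈ → proj₂ (below-∈⁻ x∈)))
       (All.tabulate I₀< ∷ subst Sorted (sym (++-assoc B (J₀ ∷ []) R))
          (Sorted-++-∷⁺ (Sorted-resp-⊆ (between-⊆ _ _ Ls) Ls-sorted) (All.tabulate (λ x∈ → proj₂ (proj₂ (between-∈⁻ x∈))))
             (All.tabulate J₀<R ∷ Sorted-flatAll-build (CubeData-tail cube) (c ∘ Fin.suc)))))
  where
  open CubeData cube
  I₀ = I Fin.zero
  J₀ = J Fin.zero
  B = between I₀ J₀ Ls
  R = flatAll (build (I ∘ Fin.suc) (J ∘ Fin.suc) (c ∘ Fin.suc) (above J₀ Ls))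
  J₀<R : ∀ {x} → x ∈ R → J₀ < x
  J₀<R x∈ with flatAll-build-∈⁻ (I ∘ Fin.suc) (J ∘ Fin.suc) (c ∘ Fin.suc) _ x∈
  ... | inj₁ x∈C = proj₂ (above-∈⁻ x∈C)
  ... | inj₂ end = J₀<tail-endpoint cube end
  I₀< : ∀ {x} → x ∈ (B ++ J₀ ∷ []) ++ R → I₀ < x
  I₀< x∈ with ∈-++⁻ (B ++ J₀ ∷ []) x∈
  ... | inj₂ x∈R = <-trans (I<J Fin.zero) (J₀<R x∈R)
  ... | inj₁ x∈BJ with ∈-++⁻ B x∈BJ
  ...   | inj₁ x∈B         = proj₁ (proj₂ (between-∈⁻ x∈B))
  ...   | inj₂ (here refl) = I<J Fin.zero

fixed⊆segAll : ∀ o → fixed o ⊆ segAll o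
fixed⊆segAll (single x)       = ⊆-refl
fixed⊆segAll (block c i xs j) = i ∷ʳ ++⁺ʳ (j ∷ []) ⊆-refl

Fixed-build : ∀ {m} (I J : Fin (suc m) → ℕ) c Ls →
  Fixed (build I J c Ls) ≡ below (I Fin.zero) Ls ++ between (I Fin.zero) (J Fin.zero) Ls
                             ++ Fixed (build (I ∘ Fin.suc) (J ∘ Fin.suc) (c ∘ Fin.suc) (above (J Fin.zero) Ls))
Fixed-build I J c Ls = concatMap-singles (λ _ → refl) (below (I Fin.zero) Ls) _

Fixed-build-∈⁻ : ∀ {m} (I J : Fin m → ℕ) c Ls {x} → x ∈ Fixed (build I J c Ls) → x ∈ Ls
Fixed-build-∈⁻ {zero}  I J c Ls {x} x∈ = subst (x ∈_) (concatMap-single (λ _ → refl) Ls) x∈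
Fixed-build-∈⁻ {suc m} I J c Ls {x} x∈ with ∈-++⁻ (below _ Ls) (subst (x ∈_) (Fixed-build I J c Ls) x∈)
... | inj₁ x∈A = proj₁ (below-∈⁻ x∈A)
... | inj₂ x∈BR with ∈-++⁻ (between _ _ Ls) x∈BR
...   | inj₁ x∈B = proj₁ (between-∈⁻ x∈B)
...   | inj₂ x∈R = proj₁ (above-∈⁻ (Fixed-build-∈⁻ (I ∘ Fin.suc) (J ∘ Fin.suc) (c ∘ Fin.suc) _ x∈R))

Fixed-build-∈⁺ : ∀ {m} {I J : Fin m → ℕ} {Ls} → CubeData I J Ls → ∀ c {x} → x ∈ Ls → x ∈ Fixed (build I J c Ls)
Fixed-build-∈⁺ {zero}  {Ls = Ls} cube c {x} x∈ = subst (x ∈_) (sym (concatMap-single (λ _ → refl) Ls)) x∈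
Fixed-build-∈⁺ {suc m} {I} {J} {Ls} cube c {x} x∈ = subst (x ∈_) (sym (Fixed-build I J c Ls)) placed
  where
  open CubeData cube
  placed : x ∈ below (I Fin.zero) Ls ++ between (I Fin.zero) (J Fin.zero) Ls ++ _
  placed with <-cmp x (I Fin.zero)
  ... | tri< x<I _ _ = ∈-++⁺ˡ (below-∈⁺ x∈ x<I)
  ... | tri≈ _ x≡I _ = ⊥-elim (Ls∌endpoint x∈ (Fin.zero , inj₁ x≡I))
  ... | tri> _ _ I<x with <-cmp x (J Fin.zero)
  ...   | tri< x<J _ _ = ∈-++⁺ʳ (below _ Ls) (∈-++⁺ˡ (between-∈⁺ x∈ (I<x , x<J)))
  ...   | tri≈ _ x≡J _ = ⊥-elim (Ls∌endpoint x∈ (Fin.zero , inj₂ x≡J))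
  ...   | tri> _ _ J<x = ∈-++⁺ʳ (below _ Ls) (∈-++⁺ʳ (between _ _ Ls)
                           (Fixed-build-∈⁺ (CubeData-tail cube) (c ∘ Fin.suc) (above-∈⁺ x∈ J<x)))

Fixed-build≡ : ∀ {m} {I J : Fin m → ℕ} {Ls} → CubeData I J Ls → ∀ c → Fixed (build I J c Ls) ≡ Ls
Fixed-build≡ {I = I} {J} {Ls} cube c =
  Sorted-≡ (Sorted-resp-⊆ (concatMap-⊆ fixed⊆segAll (build I J c Ls)) (Sorted-flatAll-build cube c)) (CubeData.Ls-sorted cube)
           (Fixed-build-∈⁻ I J c Ls) (Fixed-build-∈⁺ cube c)

length-flatS-build : ∀ {m} {I J : Fin m → ℕ} {Ls} → CubeData I J Ls → ∀ c →
                     length (flatS (build I J c Ls)) ≡ length Ls +ℕ m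
length-flatS-build {m} {I} {J} {Ls} cube c = begin
  length (flatS (build I J c Ls))                                              ≡⟨ length-flatS≡ (build I J c Ls) ⟩
  length (Fixed (build I J c Ls)) +ℕ length (orientations (build I J c Ls))
    ≡⟨ cong₂ (λ A B → length A +ℕ length B) (Fixed-build≡ cube c) (orientations-build I J c Ls) ⟩
  length Ls +ℕ length (tabulate c)                                             ≡⟨ cong (length Ls +ℕ_) (length-tabulate c) ⟩
  length Ls +ℕ m                                                               ∎
  where open ≡-Reasoning

flatS-build-∈⁻ : ∀ {m} {I J : Fin m → ℕ} {Ls} → CubeData I J Ls → ∀ c {x} →
  x ∈ flatS (build I J c Ls) → x ∈ Ls ⊎ ∃[ a ] x ≡ (if c a then I a else J a)
flatS-build-∈⁻ {I = I} {J} {Ls} cube c {x} x∈ with flatS-∈⁻ (build I J c Ls) x∈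
... | inj₁ x∈F = inj₁ (subst (x ∈_) (Fixed-build≡ cube c) x∈F)
... | inj₂ x∈O = inj₂ (∈-tabulate⁻ (subst (x ∈_) (OwnS-build I J c Ls) x∈O))

flatS-build-∈⁺ : ∀ {m} {I J : Fin m → ℕ} {Ls} → CubeData I J Ls → ∀ c {x} →
  x ∈ Ls ⊎ ∃[ a ] x ≡ (if c a then I a else J a) → x ∈ flatS (build I J c Ls)
flatS-build-∈⁺ {I = I} {J} {Ls} cube c {x} (inj₁ x∈) =
  flatS-∈⁺ (build I J c Ls) (inj₁ (subst (x ∈_) (sym (Fixed-build≡ cube c)) x∈))
flatS-build-∈⁺ {I = I} {J} {Ls} cube c {x} (inj₂ (a , refl)) =
  flatS-∈⁺ (build I J c Ls) (inj₂ (subst (x ∈_) (sym (OwnS-build I J c Ls)) (∈-tabulate⁺ a)))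

data Reorientation : Segment → Segment → Set where
  single : ∀ x → Reorientation (single x) (single x)
  block  : ∀ c c′ i xs j → Reorientation (block c i xs j) (block c′ i xs j)

Reorientation-refl : ∀ {o} → Reorientation o o
Reorientation-refl {single x}       = single x
Reorientation-refl {block c i xs j} = block c c i xs j

PairSwap-reorientation : ∀ {os os′} → Pointwise Reorientation os os′ →
                         PairSwap (flatS os) (flatT os) (flatS os′) (flatT os′)
PairSwap-reorientation []                          = []
PairSwap-reorientation (single x ∷ rs)             = keep (PairSwap-reorientation rs)
PairSwap-reorientation (block c c′ i xs j ∷ rs)    = PairSwap-++ (PairSwap-block c c′ i xs j) (PairSwap-reorientation rs)

build-reorientation : ∀ {m} (I J : Fin m → ℕ) c c′ Ls → Pointwise Reorientation (build I J c Ls) (build I J c′ Ls)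
build-reorientation {zero}  I J c c′ Ls = Pointwise.refl Reorientation-refl
build-reorientation {suc m} I J c c′ Ls =
  Pointwise.++⁺ˡ Reorientation-refl (map single (below (I Fin.zero) Ls))
    (block (c Fin.zero) (c′ Fin.zero) _ _ _ ∷ build-reorientation (I ∘ Fin.suc) (J ∘ Fin.suc) (c ∘ Fin.suc) (c′ ∘ Fin.suc) _)

-- Subsets of [n]

val : ∀ {n} → Fin n → ℕ
val f = suc (toℕ f)

elemsFrom-positive : ∀ {n} o (S : Subset n) → All (o <_) (elemsFrom o S)
elemsFrom-positive o []          = []
elemsFrom-positive o (true ∷ S)  = ≤-refl ∷ All.map (<-trans (n<1+n o)) (elemsFrom-positive (suc o) S)
elemsFrom-positive o (false ∷ S) = All.map (<-trans (n<1+n o)) (elemsFrom-positive (suc o) S)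

elemsFrom-sorted : ∀ {n} o (S : Subset n) → Sorted (elemsFrom o S)
elemsFrom-sorted o []          = []
elemsFrom-sorted o (true ∷ S)  = elemsFrom-positive (suc o) S ∷ elemsFrom-sorted (suc o) S
elemsFrom-sorted o (false ∷ S) = elemsFrom-sorted (suc o) S

elemsFrom-∈⁺ : ∀ {n} o (S : Subset n) {f} → f ∈ˢ S → o +ℕ val f ∈ elemsFrom o S
elemsFrom-∈⁺ o (true ∷ S)  here = here (+-comm o 1)
elemsFrom-∈⁺ o (b ∷ S) {Fin.suc f} (there f∈) with elemsFrom-∈⁺ (suc o) S f∈
... | x∈ rewrite sym (+-suc o (val f)) with b
...   | true  = there x∈
...   | false = x∈

elemsFrom-∈⁻ : ∀ {n} o (S : Subset n) {x} → x ∈ elemsFrom o S → ∃[ f ] (f ∈ˢ S × x ≡ o +ℕ val f)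
elemsFrom-∈⁻ o (true ∷ S)  (here x≡)  = Fin.zero , here , trans x≡ (sym (+-comm o 1))
elemsFrom-∈⁻ o (true ∷ S)  (there x∈) with f , f∈ , x≡ ← elemsFrom-∈⁻ (suc o) S x∈ =
  Fin.suc f , there f∈ , trans x≡ (sym (+-suc o (val f)))
elemsFrom-∈⁻ o (false ∷ S) x∈        with f , f∈ , x≡ ← elemsFrom-∈⁻ (suc o) S x∈ =
  Fin.suc f , there f∈ , trans x≡ (sym (+-suc o (val f)))

elems-∈⁺ : ∀ {n} (S : Subset n) {f} → f ∈ˢ S → val f ∈ elems S
elems-∈⁺ = elemsFrom-∈⁺ 0

elems-∈⁻ : ∀ {n} (S : Subset n) {x} → x ∈ elems S → ∃[ f ] (f ∈ˢ S × x ≡ val f)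
elems-∈⁻ = elemsFrom-∈⁻ 0

∈-⋃-allFin⁻ : ∀ {n m} (F : Fin m → Subset n) {f} → f ∈ˢ ⋃ (map F (allFin m)) → ∃[ a ] f ∈ˢ F a
∈-⋃-allFin⁻ {m = m} F f∈ = Any.satisfied (Any.map⁻ (∈-⋃⁻ (map F (allFin m)) f∈))
  where
  ∈-⋃⁻ : ∀ {n} (Ss : List (Subset n)) {f} → f ∈ˢ ⋃ Ss → Any (f ∈ˢ_) Ss
  ∈-⋃⁻ []       f∈ = ⊥-elim (Subsetₚ.∉⊥ f∈)
  ∈-⋃⁻ (S ∷ Ss) f∈ with Subsetₚ.x∈p∪q⁻ S (⋃ Ss) f∈
  ... | inj₁ f∈S  = here f∈S
  ... | inj₂ f∈Ss = there (∈-⋃⁻ Ss f∈Ss)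

∈-⋃-allFin⁺ : ∀ {n m} (F : Fin m → Subset n) a {f} → f ∈ˢ F a → f ∈ˢ ⋃ (map F (allFin m))
∈-⋃-allFin⁺ {m = m} F a f∈ = ∈-⋃⁺ (map F (allFin m)) (Any.map⁺ (lose (∈-allFin a) f∈))
  where
  ∈-⋃⁺ : ∀ {n} (Ss : List (Subset n)) {f} → Any (f ∈ˢ_) Ss → f ∈ˢ ⋃ Ss
  ∈-⋃⁺ (S ∷ Ss) (here f∈S)  = Subsetₚ.x∈p∪q⁺ (inj₁ f∈S)
  ∈-⋃⁺ (S ∷ Ss) (there f∈Ss) = Subsetₚ.x∈p∪q⁺ (inj₂ (∈-⋃⁺ Ss f∈Ss))

∈-─⁻ : ∀ {n} (p q : Subset n) {f} → f ∈ˢ p ─ q → f ∈ˢ p × f ∉ˢ q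
∈-─⁻ (true ∷ p) (false ∷ q) here      = here , λ ()
∈-─⁻ (_ ∷ p)    (true ∷ q)  (there f∈) = Product.map there (λ f∉q → λ { (there f∈q) → f∉q f∈q }) (∈-─⁻ p q f∈)
∈-─⁻ (_ ∷ p)    (false ∷ q) (there f∈) = Product.map there (λ f∉q → λ { (there f∈q) → f∉q f∈q }) (∈-─⁻ p q f∈)

∈-─⁺ : ∀ {n} (p q : Subset n) {f} → f ∈ˢ p → f ∉ˢ q → f ∈ˢ p ─ q
∈-─⁺ (true ∷ p) (false ∷ q) here       _   = here
∈-─⁺ (true ∷ p) (true ∷ q)  here       f∉q = ⊥-elim (f∉q here)
∈-─⁺ (_ ∷ p)    (true ∷ q)  (there f∈) f∉q = there (∈-─⁺ p q f∈ (f∉q ∘ there))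
∈-─⁺ (_ ∷ p)    (false ∷ q) (there f∈) f∉q = there (∈-─⁺ p q f∈ (f∉q ∘ there))

strictlyMonotone⇒injective : ∀ {m} (f : Fin m → ℕ) → (∀ {a b} → toℕ a < toℕ b → f a < f b) →
                             ∀ {a b} → f a ≡ f b → a ≡ b
strictlyMonotone⇒injective f mono {a} {b} fa≡fb with <-cmp (toℕ a) (toℕ b)
... | tri< a<b _ _ = ⊥-elim (<-irrefl fa≡fb (mono a<b))
... | tri≈ _ a≡b _ = Finₚ.toℕ-injective a≡b
... | tri> _ _ b<a = ⊥-elim (<-irrefl (sym fa≡fb) (mono b<a))

startingWith : ∀ {m} → Bool → Fin m → Bool
startingWith b Fin.zero    = b
startingWith b (Fin.suc a) = startingWith (not b) a

startingWith-not : ∀ {m} b (a : Fin m) → startingWith (not b) a ≡ not (startingWith b a)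
startingWith-not b Fin.zero    = refl
startingWith-not b (Fin.suc a) = startingWith-not (not b) a

altChoice≡startingWith-true : ∀ {m} (a : Fin m) → altChoice a ≡ startingWith true a
altChoice≡startingWith-true Fin.zero           = refl
altChoice≡startingWith-true (Fin.suc Fin.zero) = refl
altChoice≡startingWith-true (Fin.suc (Fin.suc a)) = altChoice≡startingWith-true a

alternating⇒startingWith : ∀ {m} (c : Fin (suc m) → Bool) → Alternating (tabulate c) →
                           ∀ a → c a ≡ startingWith (c Fin.zero) a
alternating⇒startingWith c _ Fin.zero = refl
alternating⇒startingWith {suc m} c (c₁≡ ∷ alt) (Fin.suc a) =
  trans (alternating⇒startingWith (c ∘ Fin.suc) alt a) (cong (λ b → startingWith b a) c₁≡)

startingWith⇒alternating : ∀ {m} b (c : Fin m → Bool) → (∀ a → c a ≡ startingWith b a) → Alternating (tabulate c)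
startingWith⇒alternating {zero}        b c c≗ = []
startingWith⇒alternating {suc zero}    b c c≗ = [-]
startingWith⇒alternating {suc (suc m)} b c c≗ =
  trans (c≗ (Fin.suc Fin.zero)) (cong not (sym (c≗ Fin.zero)))
  ∷ startingWith⇒alternating (not b) (c ∘ Fin.suc) (c≗ ∘ Fin.suc)

alternating⇔altChoice : ∀ {m} (c : Fin m → Bool) →
  Alternating (tabulate c) ⇔ ((∀ a → c a ≡ altChoice a) ⊎ (∀ a → c a ≡ not (altChoice a)))
alternating⇔altChoice {m} c = mk⇔ (to m c) from
  where
  altChoice-not : ∀ {m} (a : Fin m) → not (altChoice a) ≡ startingWith false a
  altChoice-not a = trans (cong not (altChoice≡startingWith-true a)) (sym (startingWith-not true a))
  to : ∀ m (c : Fin m → Bool) → Alternating (tabulate c) →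
       (∀ a → c a ≡ altChoice a) ⊎ (∀ a → c a ≡ not (altChoice a))
  to zero    c _   = inj₁ λ ()
  to (suc m) c alt with c Fin.zero | alternating⇒startingWith c alt
  ... | true  | c≗ = inj₁ (λ a → trans (c≗ a) (sym (altChoice≡startingWith-true a)))
  ... | false | c≗ = inj₂ (λ a → trans (c≗ a) (sym (altChoice-not a)))
  from : (∀ a → c a ≡ altChoice a) ⊎ (∀ a → c a ≡ not (altChoice a)) → Alternating (tabulate c)
  from (inj₁ c≗) = startingWith⇒alternating true  c (λ a → trans (c≗ a) (altChoice≡startingWith-true a))
  from (inj₂ c≗) = startingWith⇒alternating false c (λ a → trans (c≗ a) (altChoice-not a))

module CubePairs {n m} (i j : Fin m → Fin n)
  (i<j : ∀ a → toℕ (i a) < toℕ (j a))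
  (j<i : ∀ a b → toℕ a < toℕ b → toℕ (j a) < toℕ (i b)) where

  choose : (Fin m → Bool) → Fin m → Fin n
  choose c a = if c a then i a else j a

  Msel-∈⁻ : ∀ c {f} → f ∈ˢ Msel i j c → ∃[ a ] f ≡ choose c a
  Msel-∈⁻ c f∈ with a , f∈⁅⁆ ← ∈-⋃-allFin⁻ (λ a → ⁅ choose c a ⁆) f∈ = a , Subsetₚ.x∈⁅y⁆⇒x≡y _ f∈⁅⁆

  Msel-∈⁺ : ∀ c a → choose c a ∈ˢ Msel i j c
  Msel-∈⁺ c a = ∈-⋃-allFin⁺ (λ a → ⁅ choose c a ⁆) a (Subsetₚ.x∈⁅x⁆ _)

  IJ-∈⁻ : ∀ {f} → f ∈ˢ IJ i j → ∃[ a ] (f ≡ i a ⊎ f ≡ j a)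
  IJ-∈⁻ f∈ with a , f∈a ← ∈-⋃-allFin⁻ (λ a → ⁅ i a ⁆ ∪ˢ ⁅ j a ⁆) f∈ =
    a , Sum.map (Subsetₚ.x∈⁅y⁆⇒x≡y _) (Subsetₚ.x∈⁅y⁆⇒x≡y _) (Subsetₚ.x∈p∪q⁻ _ _ f∈a)

  IJ-∈⁺ : ∀ a {f} → f ≡ i a ⊎ f ≡ j a → f ∈ˢ IJ i j
  IJ-∈⁺ a f≡ = ∈-⋃-allFin⁺ (λ a → ⁅ i a ⁆ ∪ˢ ⁅ j a ⁆) a
    (Subsetₚ.x∈p∪q⁺ (Sum.map (λ { refl → Subsetₚ.x∈⁅x⁆ _ }) (λ { refl → Subsetₚ.x∈⁅x⁆ _ }) f≡))

  i-injective : ∀ {a b} → i a ≡ i b → a ≡ b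
  i-injective e = strictlyMonotone⇒injective (toℕ ∘ i) (λ {a} {b} a<b → <-trans (i<j a) (j<i a b a<b)) (cong toℕ e)

  j-injective : ∀ {a b} → j a ≡ j b → a ≡ b
  j-injective e = strictlyMonotone⇒injective (toℕ ∘ j) (λ {a} {b} a<b → <-trans (j<i a b a<b) (i<j b)) (cong toℕ e)

  i≢j : ∀ a b → i a ≢ j b
  i≢j a b e with <-cmp (toℕ a) (toℕ b)
  ... | tri< a<b _ _ = <-irrefl (cong toℕ e) (<-trans (i<j a) (<-trans (j<i a b a<b) (i<j b)))
  ... | tri≈ _ a≡b _ rewrite Finₚ.toℕ-injective a≡b = <-irrefl (cong toℕ e) (i<j b)
  ... | tri> _ _ b<a = <-irrefl (cong toℕ (sym e)) (j<i b a b<a)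

  choose-not≢choose : ∀ c a b → choose (not ∘ c) a ≢ choose c b
  choose-not≢choose c a b e with c a in ca | c b in cb
  ... | true  | true  = i≢j b a (sym e)
  ... | false | false = i≢j a b e
  ... | true  | false with refl ← j-injective e = not-¬ ca cb
  ... | false | true  with refl ← i-injective e = not-¬ cb ca

  Msel-∈⁺′ : ∀ c a {b} → c a ≡ b → (if b then i a else j a) ∈ˢ Msel i j c
  Msel-∈⁺′ c a refl = Msel-∈⁺ c a

  Mbar≡Msel-not : ∀ c → Mbar i j c ≡ Msel i j (not ∘ c)
  Mbar≡Msel-not c = Subsetₚ.⊆-antisym Mbar⊆ Msel⊆
    where
    Mbar⊆ : ∀ {f} → f ∈ˢ Mbar i j c → f ∈ˢ Msel i j (not ∘ c)
    Mbar⊆ f∈ with f∈IJ , f∉M ← ∈-─⁻ (IJ i j) (Msel i j c) f∈ with IJ-∈⁻ f∈IJ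
    ... | a , f≡ with c a in ca | f≡
    ...   | true  | inj₂ refl = Msel-∈⁺′ (not ∘ c) a (cong not ca)
    ...   | false | inj₁ refl = Msel-∈⁺′ (not ∘ c) a (cong not ca)
    ...   | true  | inj₁ refl = ⊥-elim (f∉M (Msel-∈⁺′ c a ca))
    ...   | false | inj₂ refl = ⊥-elim (f∉M (Msel-∈⁺′ c a ca))
    Msel⊆ : ∀ {f} → f ∈ˢ Msel i j (not ∘ c) → f ∈ˢ Mbar i j c
    Msel⊆ f∈ with a , refl ← Msel-∈⁻ (not ∘ c) f∈ =
      ∈-─⁺ (IJ i j) (Msel i j c) (IJ-∈⁺ a (either (c a)))
        (λ f∈M → let b , f≡ = Msel-∈⁻ c f∈M in choose-not≢choose c a b f≡)
      where
      either : ∀ b → (if not b then i a else j a) ≡ i a ⊎ (if not b then i a else j a) ≡ j a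
      either true  = inj₂ refl
      either false = inj₁ refl

  Msel-cong : ∀ {c d} → (∀ a → c a ≡ d a) → Msel i j c ≡ Msel i j d
  Msel-cong c≗d = cong ⋃ (map-cong (λ a → cong (λ b → ⁅ (if b then i a else j a) ⁆) (c≗d a)) (allFin m))

  i∈Msel⇒true : ∀ c a → i a ∈ˢ Msel i j c → c a ≡ true
  i∈Msel⇒true c a i∈ with b , e ← Msel-∈⁻ c i∈ | c b in cb
  ... | true  with refl ← i-injective e = cb
  ... | false = ⊥-elim (i≢j a b e)

  Msel-injective : ∀ {c d} → Msel i j c ≡ Msel i j d → ∀ a → c a ≡ d a
  Msel-injective {c} {d} M≡ a = ⇔→≡ (mk⇔
    (λ ca → i∈Msel⇒true d a (subst (i a ∈ˢ_) M≡ (Msel-∈⁺′ c a ca)))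
    (λ da → i∈Msel⇒true c a (subst (i a ∈ˢ_) (sym M≡) (Msel-∈⁺′ d a da))))

  alternating⇔alternatingChoice : ∀ c → Alternating (tabulate c) ⇔
                                  (Msel i j c ≡ Msel i j altChoice ⊎ Msel i j c ≡ Mbar i j altChoice)
  alternating⇔alternatingChoice c = mk⇔
    (Sum.map Msel-cong (λ c≗ → trans (Msel-cong c≗) (sym (Mbar≡Msel-not altChoice))) ∘ Equivalence.to (alternating⇔altChoice c))
    (Equivalence.from (alternating⇔altChoice c)
      ∘ Sum.map Msel-injective (λ M≡ → Msel-injective (trans M≡ (Mbar≡Msel-not altChoice))))

length-elemsFrom : ∀ {n} o (S : Subset n) → length (elemsFrom o S) ≡ ∣ S ∣
length-elemsFrom o []          = refl
length-elemsFrom o (true ∷ S)  = cong suc (length-elemsFrom (suc o) S)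
length-elemsFrom o (false ∷ S) = length-elemsFrom (suc o) S

module VertexPairs {n m} (i j : Fin m → Fin n)
  (i<j : ∀ a → toℕ (i a) < toℕ (j a))
  (j<i : ∀ a b → toℕ a < toℕ b → toℕ (j a) < toℕ (i b))
  (L : Subset n) (L∌IJ : ∀ x → x ∈ˢ L → x ∉ˢ IJ i j) where

  open CubePairs i j i<j j<i

  I J : Fin m → ℕ
  I = val ∘ i
  J = val ∘ j

  cube : CubeData I J (elems L)
  cube = record
    { I<J         = λ a → s≤s (i<j a)
    ; J<I         = λ a b a<b → s≤s (j<i a b a<b)
    ; Ls-sorted   = elemsFrom-sorted 0 L
    ; Ls∌endpoint = λ x∈ (a , x≡) → let f , f∈L , x≡f = elems-∈⁻ L x∈ in
        L∌IJ f f∈L (IJ-∈⁺ a (Sum.map (val-injective ∘ trans (sym x≡f)) (val-injective ∘ trans (sym x≡f)) x≡))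
    }
    where
    val-injective : ∀ {f g : Fin n} → val f ≡ val g → f ≡ g
    val-injective = Finₚ.toℕ-injective ∘ suc-injective

  val-choose : ∀ c a → val (choose c a) ≡ (if c a then I a else J a)
  val-choose c a with c a
  ... | true  = refl
  ... | false = refl

  elems-Msel-∪ : ∀ c → elems (Msel i j c ∪ˢ L) ≡ flatS (build I J c (elems L))
  elems-Msel-∪ c = Sorted-≡ (elemsFrom-sorted 0 (Msel i j c ∪ˢ L))
    (Sorted-resp-⊆ (flatS⊆flatAll (build I J c (elems L))) (Sorted-flatAll-build cube c)) ⊆flatS flatS⊆
    where
    ⊆flatS : ∀ {x} → x ∈ elems (Msel i j c ∪ˢ L) → x ∈ flatS (build I J c (elems L))
    ⊆flatS x∈ with f , f∈ , x≡ ← elems-∈⁻ (Msel i j c ∪ˢ L) x∈ =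
      subst (_∈ _) (sym x≡) (val∈ (Subsetₚ.x∈p∪q⁻ (Msel i j c) L f∈))
      where
      val∈ : ∀ {f} → f ∈ˢ Msel i j c ⊎ f ∈ˢ L → val f ∈ flatS (build I J c (elems L))
      val∈ (inj₂ f∈L) = flatS-build-∈⁺ cube c (inj₁ (elems-∈⁺ L f∈L))
      val∈ (inj₁ f∈M) with a , refl ← Msel-∈⁻ c f∈M = flatS-build-∈⁺ cube c (inj₂ (a , val-choose c a))
    flatS⊆ : ∀ {x} → x ∈ flatS (build I J c (elems L)) → x ∈ elems (Msel i j c ∪ˢ L)
    flatS⊆ x∈ with flatS-build-∈⁻ cube c x∈
    ... | inj₁ x∈L with f , f∈L , x≡ ← elems-∈⁻ L x∈L =
      subst (_∈ _) (sym x≡) (elems-∈⁺ (Msel i j c ∪ˢ L) (Subsetₚ.x∈p∪q⁺ (inj₂ f∈L)))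
    ... | inj₂ (a , x≡) =
      subst (_∈ _) (trans (val-choose c a) (sym x≡))
            (elems-∈⁺ (Msel i j c ∪ˢ L) (Subsetₚ.x∈p∪q⁺ (inj₁ (Msel-∈⁺ c a))))

  elems-Mbar-∪ : ∀ c → elems (Mbar i j c ∪ˢ L) ≡ flatT (build I J c (elems L))
  elems-Mbar-∪ c = begin
    elems (Mbar i j c ∪ˢ L)                   ≡⟨ cong (λ M → elems (M ∪ˢ L)) (Mbar≡Msel-not c) ⟩
    elems (Msel i j (not ∘ c) ∪ˢ L)           ≡⟨ elems-Msel-∪ (not ∘ c) ⟩
    flatS (build I J (not ∘ c) (elems L))     ≡⟨ cong flatS (flip-build I J c (elems L)) ⟨
    flatS (map flip (build I J c (elems L)))  ≡⟨ concatMap-flip segS-flip (build I J c (elems L)) ⟩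
    flatT (build I J c (elems L))             ∎
    where open ≡-Reasoning

  module _ (k : ℕ) (|L|+m≡k : ∣ L ∣ +ℕ m ≡ k) where

    length-flatS-build≡k : ∀ c → length (flatS (build I J c (elems L))) ≡ k
    length-flatS-build≡k c = trans (length-flatS-build cube c) (trans (cong (_+ℕ m) (length-elemsFrom 0 L)) |L|+m≡k)

    Msel-∪-IsSubsetList : ∀ c → IsSubsetList k (elems (Msel i j c ∪ˢ L))
    Msel-∪-IsSubsetList c = record
      { sorted   = elemsFrom-sorted 0 (Msel i j c ∪ˢ L)
      ; positive = elemsFrom-positive 0 (Msel i j c ∪ˢ L)
      ; length≡  = trans (cong length (elems-Msel-∪ c)) (length-flatS-build≡k c) }

    Mbar-∪-IsSubsetList : ∀ c → IsSubsetList k (elems (Mbar i j c ∪ˢ L))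
    Mbar-∪-IsSubsetList c = record
      { sorted   = elemsFrom-sorted 0 (Mbar i j c ∪ˢ L)
      ; positive = elemsFrom-positive 0 (Mbar i j c ∪ˢ L)
      ; length≡  = trans (cong length (elems-Mbar-∪ c))
                     (trans (sym (length-flatS (build I J c (elems L)))) (length-flatS-build≡k c)) }

    Γ-diagonal-invariant : ∀ w c c′ →
      Γ w k (elems (Msel i j c ∪ˢ L)) + Γ w k (elems (Mbar i j c ∪ˢ L))
      ≡ Γ w k (elems (Msel i j c′ ∪ˢ L)) + Γ w k (elems (Mbar i j c′ ∪ˢ L))
    Γ-diagonal-invariant w c c′ =
      Γ-PairSwap w k (PairSwap-cong (elems-Msel-∪ c) (elems-Mbar-∪ c) (elems-Msel-∪ c′) (elems-Mbar-∪ c′)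
                        (PairSwap-reorientation (build-reorientation I J c c′ (elems L))))
        (Msel-∪-IsSubsetList c) (Mbar-∪-IsSubsetList c) (Msel-∪-IsSubsetList c′) (Mbar-∪-IsSubsetList c′)

    noncrossing⇔alternatingChoice : ∀ c → Noncrossing k (Msel i j c ∪ˢ L) (Mbar i j c ∪ˢ L) ⇔
                                    (Msel i j c ≡ Msel i j altChoice ⊎ Msel i j c ≡ Mbar i j altChoice)
    noncrossing⇔alternatingChoice c =
      subst (_⇔ _) (sym Noncrossing≡)
        (⇔-trans (noncrossing⇔alternating (build I J c (elems L)) (Sorted-flatAll-build cube c))
          (subst (λ cs → Alternating cs ⇔ _) (sym (orientations-build I J c (elems L)))
            (alternating⇔alternatingChoice c)))
      where
      Noncrossing≡ : Noncrossing k (Msel i j c ∪ˢ L) (Mbar i j c ∪ˢ L) ≡ NoncrossingSegments (build I J c (elems L))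
      Noncrossing≡ = trans (cong₂ (NoncrossingList k) (elems-Msel-∪ c) (elems-Mbar-∪ c))
                           (cong (λ k′ → NoncrossingList k′ _ _) (sym (length-flatS-build≡k c)))

vsum-map : ∀ {r c} (g : ℕ → Mat r c) xs p q → vsum (map g xs) p q ≡ sumℤ (map (λ d → g d p q) xs)
vsum-map g []       p q = refl
vsum-map g (x ∷ xs) p q = cong (λ s → g x p q + s) (vsum-map g xs p q)

v≡Γ : ∀ n k S p q → v n k S p q ≡ Γ (λ ℓ t → F n k ℓ t p q) k (elems S)
v≡Γ n k S p q = trans (vsum-map _ (upTo (k ∸ 1)) p q)
  (cong sumℤ (map-cong (λ d → vsum-map (λ e → F n k (suc d) (a d +ℕ e)) (upTo (suc (b d) ∸ a d)) p q) (upTo (k ∸ 1))))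
  where
  a b : ℕ → ℕ
  a d = sel S (suc d) ∸ (suc d ∸ 1)
  b d = sel S (suc (suc d)) ∸ suc d ∸ 1

mainTheorem1 :
    (n k m : ℕ) → 2 ≤ k → k +ℕ 2 ≤ n → 2 ≤ m → m ≤ k →
    (i j : Fin m → Fin n) →
    (∀ a → toℕ (i a) < toℕ (j a)) →
    (∀ a b → toℕ a < toℕ b → toℕ (j a) < toℕ (i b)) →
    (L : Subset n) → (∀ x → x ∈ˢ L → x ∉ˢ IJ i j) → ∣ L ∣ ≡ k ∸ m →
    ((c c′ : Fin m → Bool) →
        (∀ p q → v n k (Msel i j c ∪ˢ L) p q + v n k (Mbar i j c ∪ˢ L) p q
                 ≡ v n k (Msel i j c′ ∪ˢ L) p q + v n k (Mbar i j c′ ∪ˢ L) p q)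
      × (∀ (α : Coord n k) →
           γ n k (Msel i j c ∪ˢ L) α + γ n k (Mbar i j c ∪ˢ L) α
           ≡ γ n k (Msel i j c′ ∪ˢ L) α + γ n k (Mbar i j c′ ∪ˢ L) α))
    × ((c : Fin m → Bool) →
        Noncrossing k (Msel i j c ∪ˢ L) (Mbar i j c ∪ˢ L)
        ⇔ (Msel i j c ≡ Msel i j altChoice ⊎ Msel i j c ≡ Mbar i j altChoice))
mainTheorem1 n k m _ _ _ m≤k i j i<j j<i L L∌IJ |L|≡k∸m =
  (λ c c′ → v-invariant c c′ , λ α → Γ-diagonal-invariant k |L|+m≡k (αat α) c c′)
  , noncrossing⇔alternatingChoice k |L|+m≡k
  where
  open VertexPairs i j i<j j<i L L∌IJ
  |L|+m≡k : ∣ L ∣ +ℕ m ≡ k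
  |L|+m≡k = trans (cong (_+ℕ m) |L|≡k∸m) (m∸n+n≡m m≤k)
  v-invariant : ∀ c c′ p q → v n k (Msel i j c ∪ˢ L) p q + v n k (Mbar i j c ∪ˢ L) p q
                             ≡ v n k (Msel i j c′ ∪ˢ L) p q + v n k (Mbar i j c′ ∪ˢ L) p q
  v-invariant c c′ p q =
    trans (v-pair≡Γ-pair (Msel i j c ∪ˢ L) (Mbar i j c ∪ˢ L))
      (trans (Γ-diagonal-invariant k |L|+m≡k (λ ℓ t → F n k ℓ t p q) c c′)
             (sym (v-pair≡Γ-pair (Msel i j c′ ∪ˢ L) (Mbar i j c′ ∪ˢ L))))
    where
    v-pair≡Γ-pair : ∀ A B → v n k A p q + v n k B p q
                            ≡ Γ (λ ℓ t → F n k ℓ t p q) k (elems A) + Γ (λ ℓ t → F n k ℓ t p q) k (elems B)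
    v-pair≡Γ-pair A B = cong₂ _+_ (v≡Γ n k A p q) (v≡Γ n k B p q)
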